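{- If $G$ is a finite simple graph that is bipartite, or is $K_3$, $K_4$, $K_{1,1,2}$, a path, or a cycle, then the matching polytope $P_M(G)$ has the integer decomposition property. In particular, if $G$ is a connected bipartite graph whose essential vertices all have the same degree, or $G=C_5$, then $P_M(G)$ has the integer decomposition property.
   Context: For a graph $G$ with edge set $E$, the matching polytope $P_M(G)\subset\mathbb{R}^E$ is the convex hull of the indicator vectors of all matchings of $G$. A lattice polytope $P\subset\mathbb{R}^d$ has the integer decomposition property if for every $t\in\mathbb{Z}_{>0}$ and $\alpha\in tP\cap\mathbb{Z}^d$ there exist $\alpha_1,\dots,\alpha_t\in P\cap\mathbb{Z}^d$ with $\alpha=\sum\alpha_i$. $K_{1,1,2}$ is $K_4$ minus an edge. A vertex $u$ is essential if (1) $\deg(u)=1$ and its neighbor has degree $1$, or (2) $\deg(u)=2$ and its neighbors are non-adjacent, or (3) $\deg(u)\ge3$.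
   Formalization: The matching polytope $P_M(G)$ and its dilates $tP$ are taken over ℚ rather than ℝ, so convex combinations have rational coefficients. -}

module Defs where

open import Data.Nat as ℕ using (ℕ; zero; suc; _≥_)
open import Data.Fin as Fin using (Fin; toℕ)
open import Data.Bool using (Bool; true; false; if_then_else_; _∨_)
open import Data.Integer as ℤ using (ℤ)
open import Data.Rational as ℚ using (ℚ; 0ℚ; 1ℚ)
open import Data.List using (List; []; _∷_; foldr; map)
open import Data.List.Relation.Unary.All using (All)
open import Data.Product using (Σ; ∃; _×_; _,_; proj₁; proj₂)
open import Data.Sum using (_⊎_)
open import Relation.Nullary using (¬_)
open import Relation.Nullary.Decidable using (⌊_⌋)
open import Relation.Binary.PropositionalEquality using (_≡_; _≢_)
open import Relation.Binary.Construct.Closure.ReflexiveTransitive using (Star)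
open import Function.Bundles using (_↔_; _⇔_; Inverse)

SameEdge : ∀ {n} → Fin n × Fin n → Fin n × Fin n → Set
SameEdge (a , b) (c , d) = (a ≡ c × b ≡ d) ⊎ (a ≡ d × b ≡ c)

record Graph : Set where
  field
    n      : ℕ
    m      : ℕ
    ends   : Fin m → Fin n × Fin n
    noLoop : ∀ e → proj₁ (ends e) ≢ proj₂ (ends e)
    simple : ∀ e e′ → SameEdge (ends e) (ends e′) → e ≡ e′

open Graph public

Adj : (G : Graph) → Fin (n G) → Fin (n G) → Set
Adj G u v = ∃ λ e → SameEdge (ends G e) (u , v)

degree : (G : Graph) → Fin (n G) → ℕ
degree G u = go (m G) (ends G)
  where
  go : (k : ℕ) → (Fin k → Fin (n G) × Fin (n G)) → ℕ
  go zero    f = zero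
  go (suc k) f =
    (if ⌊ proj₁ (f Fin.zero) Fin.≟ u ⌋ ∨ ⌊ proj₂ (f Fin.zero) Fin.≟ u ⌋
       then 1 else 0) ℕ.+ go k (λ i → f (Fin.suc i))

Connected : Graph → Set
Connected G = ∀ u v → Star (Adj G) u v

Bipartite : Graph → Set
Bipartite G = Σ (Fin (n G) → Bool) λ c → ∀ u v → Adj G u v → c u ≢ c v

Essential : (G : Graph) → Fin (n G) → Set
Essential G u =
    (degree G u ≡ 1 × (∀ v → Adj G u v → degree G v ≡ 1))
  ⊎ (degree G u ≡ 2 × (∀ v w → Adj G u v → Adj G u w → ¬ Adj G v w))
  ⊎ (degree G u ≥ 3)

IsoTo : (G : Graph) (k : ℕ) → (Fin k → Fin k → Set) → Set
IsoTo G k R = Σ (Fin (n G) ↔ Fin k) λ f →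
  ∀ u v → Adj G u v ⇔ R (Inverse.to f u) (Inverse.to f v)

CompleteRel : ∀ {k} → Fin k → Fin k → Set
CompleteRel i j = i ≢ j

PathRel : ∀ {k} → Fin k → Fin k → Set
PathRel i j = suc (toℕ i) ≡ toℕ j ⊎ suc (toℕ j) ≡ toℕ i

CycleRel : ∀ k → Fin k → Fin k → Set
CycleRel k i j = PathRel i j
  ⊎ (toℕ i ≡ 0 × suc (toℕ j) ≡ k) ⊎ (toℕ j ≡ 0 × suc (toℕ i) ≡ k)

-- K_{1,1,2} on {0,1,2,3} with parts {0},{1},{2,3}: all pairs except {2,3}
K112Rel : Fin 4 → Fin 4 → Set
K112Rel i j = i ≢ j × ¬ (toℕ i ≡ 2 × toℕ j ≡ 3) × ¬ (toℕ i ≡ 3 × toℕ j ≡ 2)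

IsK3 IsK4 IsK112 IsPath IsCycle : Graph → Set
IsK3 G = IsoTo G 3 CompleteRel
IsK4 G = IsoTo G 4 CompleteRel
IsK112 G = IsoTo G 4 K112Rel
IsPath G = Σ ℕ λ k → k ≥ 1 × IsoTo G k PathRel
IsCycle G = Σ ℕ λ k → k ≥ 3 × IsoTo G k (CycleRel k)

-- Polytopes given as convex hulls of sets of integer points (over ℚ)

ℤ→ℚ : ℤ → ℚ
ℤ→ℚ z = z ℚ./ 1

sumℚ : List ℚ → ℚ
sumℚ = foldr ℚ._+_ 0ℚ

sumFinℤ : ∀ {t} → (Fin t → ℤ) → ℤ
sumFinℤ {zero}  f = ℤ.+ 0
sumFinℤ {suc t} f = f Fin.zero ℤ.+ sumFinℤ (λ j → f (Fin.suc j))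

InConv : ∀ {d} → ((Fin d → ℤ) → Set) → (Fin d → ℚ) → Set
InConv {d} S x = Σ (List (ℚ × (Fin d → ℤ))) λ L →
    All (λ p → (0ℚ ℚ.≤ proj₁ p) × S (proj₂ p)) L
  × sumℚ (map proj₁ L) ≡ 1ℚ
  × (∀ i → x i ≡ sumℚ (map (λ p → proj₁ p ℚ.* ℤ→ℚ (proj₂ p i)) L))

InDilate : ∀ {d} → ((Fin d → ℤ) → Set) → ℕ → (Fin d → ℤ) → Set
InDilate S t α = Σ _ λ x → InConv S x × (∀ i → ℤ→ℚ (α i) ≡ ℤ→ℚ (ℤ.+ t) ℚ.* x i)

IDP : ∀ {d} → ((Fin d → ℤ) → Set) → Set
IDP {d} S = ∀ (t : ℕ) → t ≥ 1 → ∀ (α : Fin d → ℤ) → InDilate S t α →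
  Σ (Fin t → Fin d → ℤ) λ β →
    (∀ j → InConv S (λ i → ℤ→ℚ (β j i))) × (∀ i → α i ≡ sumFinℤ (λ j → β j i))

Disjoint : ∀ {k} → Fin k × Fin k → Fin k × Fin k → Set
Disjoint (a , b) (c , d) = a ≢ c × a ≢ d × b ≢ c × b ≢ d

IsMatching : (G : Graph) → (Fin (m G) → Bool) → Set
IsMatching G M = ∀ e e′ → M e ≡ true → M e′ ≡ true → e ≢ e′ →
  Disjoint (ends G e) (ends G e′)

indicator : ∀ {k} → (Fin k → Bool) → Fin k → ℤ
indicator M e = if M e then ℤ.+ 1 else ℤ.+ 0

MatchingVec : (G : Graph) → (Fin (m G) → ℤ) → Set
MatchingVec G v = ∃ λ M → IsMatching G M × (∀ e → v e ≡ indicator M e)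

MatchingPolytopeIDP : Graph → Set
MatchingPolytopeIDP G = IDP (MatchingVec G)

SameEssentialDegree : Graph → Set
SameEssentialDegree G = ∀ u v → Essential G u → Essential G v → degree G u ≡ degree G v

-- A point α of t·P_M(G) is a non-negative integer vector that satisfies, scaled by t, every
-- inequality Σ_{e ∈ F} x_e ≤ b valid for all matchings: every vertex has α-degree at most t,
-- every set of pairwise intersecting edges has weight at most t, and on C_{2r+1} the total
-- weight is at most t·r. It suffices to split such a weighting into t matchings. For bipartite
-- graphs (so also paths and even cycles) this is König's edge-colouring theorem, proved by
-- Kempe-chain recolouring. On at most four vertices the edges fall into at most three classes,
-- the perfect matchings of K₄: edges of one class are disjoint and edges of different classes
-- meet, so one heaviest edge per class forms a clique and the classes can be stacked into t
-- matchings. On an odd cycle an unused edge leaves a path; otherwise the total bound yields a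
-- vertex of degree less than t, and removing the near-perfect matching that misses it lowers
-- t by one.

module Submission where

open import Defs
open import Data.Nat as ℕ using (ℕ; zero; suc; _+_; _*_; _∸_; _≤_; _<_; z≤n; s≤s; NonZero)
import Data.Nat.Properties as ℕP
open import Data.Nat.DivMod using (_%_; m%n<n; m<n⇒m%n≡m; %-distribˡ-+; m%n%n≡m%n; [m+n]%n≡m%n; n%n≡0)
open import Data.Fin as Fin using (Fin; toℕ)
open import Data.Fin.Patterns using (0F; 1F; 2F; 3F)
import Data.Fin.Properties as FinP
import Data.Fin.Permutation as Perm
import Data.Fin.Permutation.Components as PC
open import Data.Bool as Bool using (Bool; true; false; if_then_else_; _∨_; _∧_; not; T)
import Data.Bool.Properties as BoolP
open import Data.Integer as ℤ using (ℤ)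
import Data.Integer.Properties as ℤP
open import Data.Rational as ℚ using (ℚ; 0ℚ; 1ℚ)
import Data.Rational.Properties as ℚP
open import Data.Rational.Unnormalised as ℚᵘ using (mkℚᵘ; *≡*; *≤*) renaming (_≃_ to _≃ᵘ_)
import Data.Rational.Unnormalised.Properties as ℚᵘP
open import Data.Maybe using (Maybe; just; nothing; _>>=_; fromMaybe)
import Data.Maybe.Properties as MaybeP
open import Data.Product as Prod using (Σ; ∃; _×_; _,_; proj₁; proj₂)
open import Data.Sum using (_⊎_; inj₁; inj₂; [_,_]′)
open import Data.Empty using (⊥; ⊥-elim)
open import Data.List using (List; []; _∷_; map)
open import Data.List.Relation.Unary.All using (All; []; _∷_)
open import Function using (id; case_of_)
open import Function.Bundles using (_↔_; Inverse; Injection; Equivalence)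
open import Function.Properties.Inverse using (↔⇒↣)
open import Relation.Unary using (Decidable)
open import Relation.Nullary using (¬_; Dec; yes; no)
open import Relation.Nullary.Decidable using (⌊_⌋; _×-dec_; _⊎-dec_; _→-dec_; ¬?; from-yes)
open import Relation.Binary.PropositionalEquality
  using (_≡_; _≢_; refl; sym; trans; cong; cong₂; subst; subst₂; module ≡-Reasoning)
open import Algebra.Bundles using (CommutativeRing)
open import Algebra.Properties.Semiring.Sum ℕP.+-*-semiring
  using (sum; sum-cong-≗; ∑-distrib-+; ∑-comm; *-distribˡ-sum; sum-replicate-zero; sum-permute)
import Algebra.Properties.Semiring.Sum (CommutativeRing.semiring ℚP.+-*-commutativeRing) as ℚΣ
open import Algebra.Properties.CommutativeSemigroup (CommutativeRing.*-commutativeSemigroup ℚP.+-*-commutativeRing)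
  using (x∙yz≈y∙xz)
open import Algebra.Properties.CommutativeSemigroup ℕP.+-commutativeSemigroup using (xy∙z≈y∙xz)

𝟙 : Bool → ℕ
𝟙 b = if b then 1 else 0

⟦_⟧ : ∀ {k} → (Fin k → Bool) → Fin k → ℕ
⟦ P ⟧ i = 𝟙 (P i)

mask : Bool → ℕ → ℕ
mask b x = if b then x else 0

sum-mono-≤ : ∀ {k} {f g : Fin k → ℕ} → (∀ i → f i ≤ g i) → sum f ≤ sum g
sum-mono-≤ {zero} f≤g = z≤n
sum-mono-≤ {suc k} f≤g = ℕP.+-mono-≤ (f≤g Fin.zero) (sum-mono-≤ (λ i → f≤g (Fin.suc i)))

≤-sum : ∀ {k} (f : Fin k → ℕ) i → f i ≤ sum f
≤-sum f Fin.zero = ℕP.m≤m+n _ _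
≤-sum f (Fin.suc i) = ℕP.≤-trans (≤-sum (λ j → f (Fin.suc j)) i) (ℕP.m≤n+m _ (f Fin.zero))

sum≡0⇒≡0 : ∀ {k} (f : Fin k → ℕ) → sum f ≡ 0 → ∀ i → f i ≡ 0
sum≡0⇒≡0 f eq i = ℕP.n≤0⇒n≡0 (subst (f i ≤_) eq (≤-sum f i))

sum-ones : ∀ k → sum {k} (λ _ → 1) ≡ k
sum-ones zero = refl
sum-ones (suc k) = cong suc (sum-ones k)

sum-single : ∀ {k} (p : Fin k) x → sum (λ i → if ⌊ i Fin.≟ p ⌋ then x else 0) ≡ x
sum-single {suc k} Fin.zero x = trans (cong (x +_) (sum-replicate-zero k)) (ℕP.+-identityʳ x)
sum-single {suc k} (Fin.suc p) x = trans (sum-cong-≗ shift) (sum-single p x)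
  where
  shift : ∀ i → (if ⌊ Fin.suc i Fin.≟ Fin.suc p ⌋ then x else 0) ≡ (if ⌊ i Fin.≟ p ⌋ then x else 0)
  shift i with i Fin.≟ p
  ... | yes refl = refl
  ... | no _ = refl

sum>0⇒∃>0 : ∀ {k} (f : Fin k → ℕ) → 0 < sum f → ∃ λ i → 0 < f i
sum>0⇒∃>0 {suc k} f pos with f Fin.zero ℕ.≟ 0
... | no f₀≢0 = Fin.zero , ℕP.n≢0⇒n>0 f₀≢0
... | yes f₀≡0 with sum>0⇒∃>0 (λ i → f (Fin.suc i)) (subst (λ z → 0 < z + sum (λ i → f (Fin.suc i))) f₀≡0 pos)
... | i , fi>0 = Fin.suc i , fi>0

sum<⇒∃< : ∀ {k} (f : Fin k → ℕ) c → sum f < k * c → ∃ λ i → f i < c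
sum<⇒∃< {suc k} f c lt with f Fin.zero ℕ.<? c
... | yes f₀<c = Fin.zero , f₀<c
... | no f₀≮c with sum<⇒∃< (λ i → f (Fin.suc i)) c
                   (ℕP.+-cancelˡ-< c _ _ (ℕP.≤-<-trans (ℕP.+-monoˡ-≤ _ (ℕP.≮⇒≥ f₀≮c)) lt))
... | i , fi<c = Fin.suc i , fi<c

count-unique≤1 : ∀ {k} (P : Fin k → Bool) → (∀ i j → P i ≡ true → P j ≡ true → i ≡ j) → sum ⟦ P ⟧ ≤ 1
count-unique≤1 {zero} P unique = z≤n
count-unique≤1 {suc k} P unique with P Fin.zero in P₀
... | false = count-unique≤1 (λ i → P (Fin.suc i)) (λ i j p q → FinP.suc-injective (unique _ _ p q))
... | true = ℕP.≤-reflexive (cong suc (trans (sum-cong-≗ rest-false) (sum-replicate-zero k)))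
  where
  rest-false : ∀ i → 𝟙 (P (Fin.suc i)) ≡ 0
  rest-false i with P (Fin.suc i) in Pᵢ
  ... | false = refl
  ... | true with unique _ _ P₀ Pᵢ
  ... | ()

sum-++ : ∀ m {n} (f : Fin m → ℕ) (g : Fin n → ℕ) → sum (λ i → [ f , g ]′ (Fin.splitAt m i)) ≡ sum f + sum g
sum-++ zero f g = refl
sum-++ (suc m) f g = trans (cong (f Fin.zero +_) (trans (sum-cong-≗ shift) (sum-++ m (λ i → f (Fin.suc i)) g)))
                           (sym (ℕP.+-assoc (f Fin.zero) _ _))
  where
  shift : ∀ i → [ f , g ]′ (Fin.splitAt (suc m) (Fin.suc i)) ≡ [ (λ j → f (Fin.suc j)) , g ]′ (Fin.splitAt m i)
  shift i with Fin.splitAt m i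
  ... | inj₁ _ = refl
  ... | inj₂ _ = refl

count-below : ∀ t h → h ≤ t → sum {t} (λ j → 𝟙 (toℕ j ℕ.<ᵇ h)) ≡ h
count-below zero zero z≤n = refl
count-below (suc t) zero _ = sum-replicate-zero t
count-below (suc t) (suc h) (s≤s h≤t) = cong suc (count-below t h h≤t)

argmax : ∀ {k p} {P : Fin k → Set p} → Decidable P → (w : Fin k → ℕ) →
         (∃ λ i → P i × (∀ j → P j → w j ≤ w i)) ⊎ (∀ j → ¬ P j)
argmax {zero} P? w = inj₂ (λ ())
argmax {suc k} {P = P} P? w with argmax (λ i → P? (Fin.suc i)) (λ i → w (Fin.suc i)) | P? Fin.zero
... | inj₂ none | no ¬P₀ = inj₂ λ { Fin.zero → ¬P₀ ; (Fin.suc j) → none j }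
... | inj₂ none | yes P₀ =
  inj₁ (Fin.zero , P₀ , λ { Fin.zero _ → ℕP.≤-refl ; (Fin.suc j) Pj → ⊥-elim (none j Pj) })
... | inj₁ (i , Pi , max) | no ¬P₀ =
  inj₁ (Fin.suc i , Pi , λ { Fin.zero P₀ → ⊥-elim (¬P₀ P₀) ; (Fin.suc j) Pj → max j Pj })
... | inj₁ (i , Pi , max) | yes P₀ with w (Fin.suc i) ℕ.≤? w Fin.zero
... | yes wᵢ≤w₀ =
  inj₁ (Fin.zero , P₀ , λ { Fin.zero _ → ℕP.≤-refl ; (Fin.suc j) Pj → ℕP.≤-trans (max j Pj) wᵢ≤w₀ })
... | no wᵢ≰w₀ =
  inj₁ (Fin.suc i , Pi , λ { Fin.zero _ → ℕP.<⇒≤ (ℕP.≰⇒> wᵢ≰w₀) ; (Fin.suc j) Pj → max j Pj })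

module _ {t} (a b : Fin t) where

  transpose-cases : ∀ j → PC.transpose a b j ≡ j ⊎ (PC.transpose a b j ≡ a ⊎ PC.transpose a b j ≡ b)
  transpose-cases j with j Fin.≟ a
  ... | yes _ = inj₂ (inj₂ refl)
  ... | no _ with j Fin.≟ b
  ... | yes _ = inj₂ (inj₁ refl)
  ... | no _ = inj₁ refl

  transpose-first : PC.transpose a b a ≡ b
  transpose-first with a Fin.≟ a
  ... | yes _ = refl
  ... | no a≢a = ⊥-elim (a≢a refl)

-- Valid inequalities on dilated convex hulls

private
  ℤ→ℚ≃ : ∀ z → ℚ.toℚᵘ (ℤ→ℚ z) ≃ᵘ mkℚᵘ z 0
  ℤ→ℚ≃ z = ℚP.toℚᵘ-fromℚᵘ (mkℚᵘ z 0)

ℤ→ℚ-+ : ∀ a b → ℤ→ℚ (a ℤ.+ b) ≡ ℤ→ℚ a ℚ.+ ℤ→ℚ b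
ℤ→ℚ-+ a b = ℚP.toℚᵘ-injective (ℚᵘP.≃-trans (ℤ→ℚ≃ (a ℤ.+ b)) (ℚᵘP.≃-trans sum≃
  (ℚᵘP.≃-sym (ℚᵘP.≃-trans (ℚP.toℚᵘ-homo-+ (ℤ→ℚ a) (ℤ→ℚ b))
                          (ℚᵘP.+-cong (ℤ→ℚ≃ a) (ℤ→ℚ≃ b))))))
  where
  sum≃ : mkℚᵘ (a ℤ.+ b) 0 ≃ᵘ mkℚᵘ a 0 ℚᵘ.+ mkℚᵘ b 0
  sum≃ = *≡* (trans (ℤP.*-identityʳ (a ℤ.+ b))
           (sym (trans (ℤP.*-identityʳ _) (cong₂ ℤ._+_ (ℤP.*-identityʳ a) (ℤP.*-identityʳ b)))))

ℤ→ℚ-* : ∀ a b → ℤ→ℚ (a ℤ.* b) ≡ ℤ→ℚ a ℚ.* ℤ→ℚ b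
ℤ→ℚ-* a b = ℚP.toℚᵘ-injective (ℚᵘP.≃-trans (ℤ→ℚ≃ (a ℤ.* b)) (ℚᵘP.≃-trans product≃
  (ℚᵘP.≃-sym (ℚᵘP.≃-trans (ℚP.toℚᵘ-homo-* (ℤ→ℚ a) (ℤ→ℚ b))
                          (ℚᵘP.*-cong (ℤ→ℚ≃ a) (ℤ→ℚ≃ b))))))
  where
  product≃ : mkℚᵘ (a ℤ.* b) 0 ≃ᵘ mkℚᵘ a 0 ℚᵘ.* mkℚᵘ b 0
  product≃ = *≡* (trans (ℤP.*-identityʳ (a ℤ.* b)) (sym (ℤP.*-identityʳ _)))

ℤ→ℚ-cancel-≤ : ∀ {a b} → ℤ→ℚ a ℚ.≤ ℤ→ℚ b → a ℤ.≤ b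
ℤ→ℚ-cancel-≤ {a} {b} le
  with ℚᵘP.≤-respʳ-≃ (ℤ→ℚ≃ b) (ℚᵘP.≤-respˡ-≃ (ℤ→ℚ≃ a) (ℚP.toℚᵘ-mono-≤ le))
... | *≤* le′ = subst₂ ℤ._≤_ (ℤP.*-identityʳ a) (ℤP.*-identityʳ b) le′

ℤ→ℚ-mono-≤ : ∀ {a b} → a ℤ.≤ b → ℤ→ℚ a ℚ.≤ ℤ→ℚ b
ℤ→ℚ-mono-≤ {a} {b} le = ℚP.toℚᵘ-cancel-≤
  (ℚᵘP.≤-respʳ-≃ (ℚᵘP.≃-sym (ℤ→ℚ≃ b)) (ℚᵘP.≤-respˡ-≃ (ℚᵘP.≃-sym (ℤ→ℚ≃ a))
    (*≤* (subst₂ ℤ._≤_ (sym (ℤP.*-identityʳ a)) (sym (ℤP.*-identityʳ b)) le))))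

ℤ→ℚ-sumFinℤ : ∀ {d} (f : Fin d → ℤ) → ℤ→ℚ (sumFinℤ f) ≡ ℚΣ.sum (λ i → ℤ→ℚ (f i))
ℤ→ℚ-sumFinℤ {zero} f = refl
ℤ→ℚ-sumFinℤ {suc d} f =
  trans (ℤ→ℚ-+ (f Fin.zero) _) (cong (ℤ→ℚ (f Fin.zero) ℚ.+_) (ℤ→ℚ-sumFinℤ (λ i → f (Fin.suc i))))

dotℤ : ∀ {d} → (Fin d → ℤ) → (Fin d → ℤ) → ℤ
dotℤ c v = sumFinℤ (λ i → c i ℤ.* v i)

module _ {d} (S : (Fin d → ℤ) → Set) (c : Fin d → ℤ) (B : ℤ) (valid : ∀ v → S v → dotℤ c v ℤ.≤ B) where

  private
    dotℚ : (Fin d → ℚ) → ℚ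
    dotℚ x = ℚΣ.sum (λ i → ℤ→ℚ (c i) ℚ.* x i)

    ℤ→ℚ-dot : ∀ v → ℤ→ℚ (dotℤ c v) ≡ dotℚ (λ i → ℤ→ℚ (v i))
    ℤ→ℚ-dot v = trans (ℤ→ℚ-sumFinℤ (λ i → c i ℤ.* v i)) (ℚΣ.sum-cong-≗ (λ i → ℤ→ℚ-* (c i) (v i)))

    dot-scale : ∀ λ′ (x : Fin d → ℚ) → dotℚ (λ i → λ′ ℚ.* x i) ≡ λ′ ℚ.* dotℚ x
    dot-scale λ′ x = trans (ℚΣ.sum-cong-≗ (λ i → x∙yz≈y∙xz (ℤ→ℚ (c i)) λ′ (x i)))
                           (sym (ℚΣ.*-distribˡ-sum λ′ (λ i → ℤ→ℚ (c i) ℚ.* x i)))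

    combination : List (ℚ × (Fin d → ℤ)) → Fin d → ℚ
    combination L i = sumℚ (map (λ p → proj₁ p ℚ.* ℤ→ℚ (proj₂ p i)) L)

    dot-combination≤ : ∀ L → All (λ p → (0ℚ ℚ.≤ proj₁ p) × S (proj₂ p)) L →
                       dotℚ (combination L) ℚ.≤ sumℚ (map proj₁ L) ℚ.* ℤ→ℚ B
    dot-combination≤ [] [] = ℚP.≤-reflexive (trans
      (trans (ℚΣ.sum-cong-≗ (λ i → ℚP.*-zeroʳ (ℤ→ℚ (c i)))) (ℚΣ.sum-replicate-zero d))
      (sym (ℚP.*-zeroˡ (ℤ→ℚ B))))
    dot-combination≤ ((λ′ , v) ∷ L) ((λ′≥0 , v∈S) ∷ L-ok) = begin
      dotℚ (λ i → λ′ ℚ.* ℤ→ℚ (v i) ℚ.+ combination L i)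
        ≡⟨ ℚΣ.sum-cong-≗ (λ i → ℚP.*-distribˡ-+ (ℤ→ℚ (c i)) _ _) ⟩
      ℚΣ.sum (λ i → ℤ→ℚ (c i) ℚ.* (λ′ ℚ.* ℤ→ℚ (v i)) ℚ.+ ℤ→ℚ (c i) ℚ.* combination L i)
        ≡⟨ ℚΣ.∑-distrib-+ (λ i → ℤ→ℚ (c i) ℚ.* (λ′ ℚ.* ℤ→ℚ (v i))) _ ⟩
      dotℚ (λ i → λ′ ℚ.* ℤ→ℚ (v i)) ℚ.+ dotℚ (combination L)
        ≡⟨ cong (ℚ._+ dotℚ (combination L))
                (trans (dot-scale λ′ (λ i → ℤ→ℚ (v i))) (cong (λ′ ℚ.*_) (sym (ℤ→ℚ-dot v)))) ⟩
      λ′ ℚ.* ℤ→ℚ (dotℤ c v) ℚ.+ dotℚ (combination L)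
        ≤⟨ ℚP.+-mono-≤ (ℚP.*-monoˡ-≤-nonNeg λ′ {{ℚ.nonNegative λ′≥0}} (ℤ→ℚ-mono-≤ (valid v v∈S)))
                       (dot-combination≤ L L-ok) ⟩
      λ′ ℚ.* ℤ→ℚ B ℚ.+ sumℚ (map proj₁ L) ℚ.* ℤ→ℚ B
        ≡⟨ sym (ℚP.*-distribʳ-+ (ℤ→ℚ B) λ′ (sumℚ (map proj₁ L))) ⟩
      (λ′ ℚ.+ sumℚ (map proj₁ L)) ℚ.* ℤ→ℚ B ∎
      where open ℚP.≤-Reasoning

  InDilate⇒dot≤ : ∀ t α → InDilate S t α → dotℤ c α ℤ.≤ ℤ.+ t ℤ.* B
  InDilate⇒dot≤ t α (x , (L , L-ok , Σλ≡1 , x≡) , α≡) = ℤ→ℚ-cancel-≤ (begin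
    ℤ→ℚ (dotℤ c α)                         ≡⟨ ℤ→ℚ-dot α ⟩
    dotℚ (λ i → ℤ→ℚ (α i))                 ≡⟨ ℚΣ.sum-cong-≗ (λ i → cong (ℤ→ℚ (c i) ℚ.*_) (α≡tx i)) ⟩
    dotℚ (λ i → tℚ ℚ.* combination L i)    ≡⟨ dot-scale tℚ (combination L) ⟩
    tℚ ℚ.* dotℚ (combination L)            ≤⟨ ℚP.*-monoˡ-≤-nonNeg tℚ {{ℚ.nonNegative tℚ≥0}} (dot-combination≤ L L-ok) ⟩
    tℚ ℚ.* (sumℚ (map proj₁ L) ℚ.* ℤ→ℚ B)  ≡⟨ cong (λ s → tℚ ℚ.* (s ℚ.* ℤ→ℚ B)) Σλ≡1 ⟩
    tℚ ℚ.* (1ℚ ℚ.* ℤ→ℚ B)                  ≡⟨ cong (tℚ ℚ.*_) (ℚP.*-identityˡ (ℤ→ℚ B)) ⟩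
    tℚ ℚ.* ℤ→ℚ B                           ≡⟨ sym (ℤ→ℚ-* (ℤ.+ t) B) ⟩
    ℤ→ℚ (ℤ.+ t ℤ.* B)                      ∎)
    where
    open ℚP.≤-Reasoning
    tℚ = ℤ→ℚ (ℤ.+ t)
    α≡tx : ∀ i → ℤ→ℚ (α i) ≡ tℚ ℚ.* combination L i
    α≡tx i = trans (α≡ i) (cong (tℚ ℚ.*_) (x≡ i))
    tℚ≥0 : 0ℚ ℚ.≤ tℚ
    tℚ≥0 = ℤ→ℚ-mono-≤ {ℤ.+ 0} {ℤ.+ t} (ℤ.+≤+ z≤n)

-- Matchings, cliques and decompositions into matchings

module Incidence (G : Graph) where

  Vertex Edge : Set
  Vertex = Fin (n G)
  Edge = Fin (m G)

  end₁ end₂ : Edge → Vertex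
  end₁ e = proj₁ (ends G e)
  end₂ e = proj₂ (ends G e)

  incident : Vertex → Edge → Bool
  incident w e = ⌊ w Fin.≟ end₁ e ⌋ ∨ ⌊ w Fin.≟ end₂ e ⌋

  incident⇒ : ∀ w e → incident w e ≡ true → w ≡ end₁ e ⊎ w ≡ end₂ e
  incident⇒ w e inc with w Fin.≟ end₁ e | w Fin.≟ end₂ e
  ... | yes w≡end₁ | _ = inj₁ w≡end₁
  ... | no _ | yes w≡end₂ = inj₂ w≡end₂

  incident-end₁ : ∀ e → incident (end₁ e) e ≡ true
  incident-end₁ e with end₁ e Fin.≟ end₁ e
  ... | yes _ = refl
  ... | no ≢ = ⊥-elim (≢ refl)

  incident-end₂ : ∀ e → incident (end₂ e) e ≡ true
  incident-end₂ e with end₂ e Fin.≟ end₁ e | end₂ e Fin.≟ end₂ e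
  ... | yes _ | _ = refl
  ... | no _ | yes _ = refl
  ... | no _ | no ≢ = ⊥-elim (≢ refl)

  ⇒incident : ∀ {w e} → w ≡ end₁ e ⊎ w ≡ end₂ e → incident w e ≡ true
  ⇒incident {e = e} (inj₁ refl) = incident-end₁ e
  ⇒incident {e = e} (inj₂ refl) = incident-end₂ e

  true≢false : true ≢ false
  true≢false ()

  Disjoint-sym : ∀ {x y : Vertex × Vertex} → Disjoint x y → Disjoint y x
  Disjoint-sym (d₁₁ , d₁₂ , d₂₁ , d₂₂) =
    (λ p → d₁₁ (sym p)) , (λ p → d₂₁ (sym p)) , (λ p → d₁₂ (sym p)) , (λ p → d₂₂ (sym p))

  common⇒¬Disjoint : ∀ w {e e′} → incident w e ≡ true → incident w e′ ≡ true → ¬ Disjoint (ends G e) (ends G e′)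
  common⇒¬Disjoint w {e} {e′} inc inc′ (d₁₁ , d₁₂ , d₂₁ , d₂₂) with incident⇒ w e inc | incident⇒ w e′ inc′
  ... | inj₁ p | inj₁ q = d₁₁ (trans (sym p) q)
  ... | inj₁ p | inj₂ q = d₁₂ (trans (sym p) q)
  ... | inj₂ p | inj₁ q = d₂₁ (trans (sym p) q)
  ... | inj₂ p | inj₂ q = d₂₂ (trans (sym p) q)

  ¬common⇒Disjoint : ∀ e e′ → (∀ w → incident w e ≡ true → incident w e′ ≡ true → ⊥) →
                     Disjoint (ends G e) (ends G e′)
  ¬common⇒Disjoint e e′ none =
      (λ p → none (end₁ e) (incident-end₁ e) (⇒incident (inj₁ p)))
    , (λ p → none (end₁ e) (incident-end₁ e) (⇒incident (inj₂ p)))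
    , (λ p → none (end₂ e) (incident-end₂ e) (⇒incident (inj₁ p)))
    , (λ p → none (end₂ e) (incident-end₂ e) (⇒incident (inj₂ p)))

  other : Edge → Vertex → Vertex
  other f w = if ⌊ w Fin.≟ end₁ f ⌋ then end₂ f else end₁ f

  other-end₁ : ∀ f → other f (end₁ f) ≡ end₂ f
  other-end₁ f with end₁ f Fin.≟ end₁ f
  ... | yes _ = refl
  ... | no ≢ = ⊥-elim (≢ refl)

  other-end₂ : ∀ f → other f (end₂ f) ≡ end₁ f
  other-end₂ f with end₂ f Fin.≟ end₁ f
  ... | yes end₂≡end₁ = ⊥-elim (noLoop G f (sym end₂≡end₁))
  ... | no _ = refl

  incident-other : ∀ w f → incident w f ≡ true → incident (other f w) f ≡ true
  incident-other w f inc with incident⇒ w f inc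
  ... | inj₁ refl = subst (λ x → incident x f ≡ true) (sym (other-end₁ f)) (incident-end₂ f)
  ... | inj₂ refl = subst (λ x → incident x f ≡ true) (sym (other-end₂ f)) (incident-end₁ f)

  other-involutive : ∀ w f → incident w f ≡ true → other f (other f w) ≡ w
  other-involutive w f inc with incident⇒ w f inc
  ... | inj₁ refl = trans (cong (other f) (other-end₁ f)) (other-end₂ f)
  ... | inj₂ refl = trans (cong (other f) (other-end₂ f)) (other-end₁ f)

  matching-unique-at : ∀ {M} → IsMatching G M → ∀ w {f f′} → M f ≡ true → M f′ ≡ true →
                       incident w f ≡ true → incident w f′ ≡ true → f ≡ f′
  matching-unique-at matching w {f} {f′} Mf Mf′ inc inc′ with f Fin.≟ f′
  ... | yes f≡f′ = f≡f′
  ... | no f≢f′ = ⊥-elim (common⇒¬Disjoint w inc inc′ (matching f f′ Mf Mf′ f≢f′))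

  weight : (Edge → Bool) → (Edge → ℕ) → ℕ
  weight F a = sum (λ e → mask (F e) (a e))

  weight-cong : ∀ F {x y} → (∀ e → x e ≡ y e) → weight F x ≡ weight F y
  weight-cong F x≡y = sum-cong-≗ (λ e → cong (mask (F e)) (x≡y e))

  weight-+ : ∀ F x y → weight F (λ e → x e + y e) ≡ weight F x + weight F y
  weight-+ F x y = trans (sum-cong-≗ (λ e → mask-+ (F e))) (∑-distrib-+ (λ e → mask (F e) (x e)) (λ e → mask (F e) (y e)))
    where
    mask-+ : ∀ {e} b → mask b (x e + y e) ≡ mask b (x e) + mask b (y e)
    mask-+ true = refl
    mask-+ false = refl

  weight-mono-≤ : ∀ F {x y} → (∀ e → x e ≤ y e) → weight F x ≤ weight F y
  weight-mono-≤ F x≤y = sum-mono-≤ (λ e → mask-mono (F e) (x≤y e))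
    where
    mask-mono : ∀ b {m n} → m ≤ n → mask b m ≤ mask b n
    mask-mono true m≤n = m≤n
    mask-mono false _ = z≤n

  weight-single : ∀ F e → weight F (λ f → 𝟙 ⌊ f Fin.≟ e ⌋) ≡ 𝟙 (F e)
  weight-single F e = trans (sum-cong-≗ at-e) (sum-single e (mask (F e) 1))
    where
    at-e : ∀ f → mask (F f) (𝟙 ⌊ f Fin.≟ e ⌋) ≡ (if ⌊ f Fin.≟ e ⌋ then mask (F e) 1 else 0)
    at-e f with f Fin.≟ e
    ... | yes refl = refl
    ... | no _ = mask-zero (F f)
      where
      mask-zero : ∀ b → mask b 0 ≡ 0
      mask-zero true = refl
      mask-zero false = refl

  degreeOf : (Edge → ℕ) → Vertex → ℕ
  degreeOf a w = weight (incident w) a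

  ≤-degreeOf : ∀ a e → a e ≤ degreeOf a (end₁ e)
  ≤-degreeOf a e = subst (_≤ degreeOf a (end₁ e)) (cong (λ b → mask b (a e)) (incident-end₁ e))
                     (≤-sum (λ f → mask (incident (end₁ e) f) (a f)) e)

  size : (Edge → Bool) → ℕ
  size M = sum ⟦ M ⟧

  Clique : (Edge → Bool) → Set
  Clique F = ∀ e e′ → F e ≡ true → F e′ ≡ true → e ≢ e′ → ¬ Disjoint (ends G e) (ends G e′)

  incident-Clique : ∀ w → Clique (incident w)
  incident-Clique w e e′ inc inc′ _ = common⇒¬Disjoint w inc inc′

  matching-meets-clique≤1 : ∀ {M} → IsMatching G M → ∀ {F} → Clique F → weight F ⟦ M ⟧ ≤ 1
  matching-meets-clique≤1 {M} matching {F} clique =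
    subst (_≤ 1) (sum-cong-≗ both) (count-unique≤1 (λ e → F e ∧ M e) unique)
    where
    both : ∀ e → 𝟙 (F e ∧ M e) ≡ mask (F e) (𝟙 (M e))
    both e with F e
    ... | true = refl
    ... | false = refl
    split : ∀ {x y} → (x ∧ y) ≡ true → x ≡ true × y ≡ true
    split {true} {true} _ = refl , refl
    unique : ∀ e e′ → (F e ∧ M e) ≡ true → (F e′ ∧ M e′) ≡ true → e ≡ e′
    unique e e′ p q with e Fin.≟ e′ | split {F e} p | split {F e′} q
    ... | yes e≡e′ | _ | _ = e≡e′
    ... | no e≢e′ | Fe , Me | Fe′ , Me′ = ⊥-elim (clique e e′ Fe Fe′ e≢e′ (matching e e′ Me Me′ e≢e′))

  handshake : ∀ a → sum (degreeOf a) ≡ 2 * sum a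
  handshake a = begin
    sum (λ w → sum (λ e → mask (incident w e) (a e)))  ≡⟨ ∑-comm (λ w e → mask (incident w e) (a e)) ⟩
    sum (λ e → sum (λ w → mask (incident w e) (a e)))  ≡⟨ sum-cong-≗ (λ e → trans (sum-cong-≗ (split e)) (both-ends e)) ⟩
    sum (λ e → 2 * a e)                                ≡⟨ sym (*-distribˡ-sum 2 a) ⟩
    2 * sum a                                          ∎
    where
    open ≡-Reasoning
    at : Vertex → Vertex → ℕ → ℕ
    at v w x = if ⌊ w Fin.≟ v ⌋ then x else 0
    split : ∀ e w → mask (incident w e) (a e) ≡ at (end₁ e) w (a e) + at (end₂ e) w (a e)
    split e w with w Fin.≟ end₁ e | w Fin.≟ end₂ e
    ... | yes refl | yes w≡end₂ = ⊥-elim (noLoop G e w≡end₂)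
    ... | yes _ | no _ = sym (ℕP.+-identityʳ (a e))
    ... | no _ | yes _ = refl
    ... | no _ | no _ = refl
    both-ends : ∀ e → sum (λ w → at (end₁ e) w (a e) + at (end₂ e) w (a e)) ≡ 2 * a e
    both-ends e = begin
      sum (λ w → at (end₁ e) w (a e) + at (end₂ e) w (a e))
        ≡⟨ ∑-distrib-+ (λ w → at (end₁ e) w (a e)) (λ w → at (end₂ e) w (a e)) ⟩
      sum (λ w → at (end₁ e) w (a e)) + sum (λ w → at (end₂ e) w (a e))
        ≡⟨ cong₂ _+_ (sum-single (end₁ e) (a e)) (sum-single (end₂ e) (a e)) ⟩
      a e + a e
        ≡⟨ cong (a e +_) (sym (ℕP.+-identityʳ (a e))) ⟩
      2 * a e ∎

  matching-size : ∀ {M} → IsMatching G M → 2 * size M ≤ n G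
  matching-size {M} matching = begin
    2 * size M                           ≡⟨ handshake ⟦ M ⟧ ⟨
    sum (degreeOf ⟦ M ⟧)       ≤⟨ sum-mono-≤ (λ w → matching-meets-clique≤1 matching (incident-Clique w)) ⟩
    sum {n G} (λ _ → 1)                  ≡⟨ sum-ones (n G) ⟩
    n G                                  ∎
    where open ℕP.≤-Reasoning

  multiplicity : ∀ {t} → (Fin t → Edge → Bool) → Edge → ℕ
  multiplicity β e = sum (λ j → 𝟙 (β j e))

  Decomposition : ℕ → (Edge → ℕ) → Set
  Decomposition t a = Σ (Fin t → Edge → Bool) λ β → (∀ j → IsMatching G (β j)) × (∀ e → multiplicity β e ≡ a e)

  matching-decomposition : ∀ {M} → IsMatching G M → Decomposition 1 ⟦ M ⟧
  matching-decomposition {M} matching = (λ _ → M) , (λ _ → matching) , λ e → ℕP.+-identityʳ (𝟙 (M e))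

  empty-decomposition : ∀ t → Decomposition t (λ _ → 0)
  empty-decomposition t = (λ _ _ → false) , (λ _ _ _ ()) , λ _ → sum-replicate-zero t

  decomposition-cong : ∀ {t a b} → (∀ e → a e ≡ b e) → Decomposition t a → Decomposition t b
  decomposition-cong a≡b (β , matchings , multiplicity≡) = β , matchings , λ e → trans (multiplicity≡ e) (a≡b e)

  decomposition-+ : ∀ {t₁ t₂ a₁ a₂} → Decomposition t₁ a₁ → Decomposition t₂ a₂ →
                    Decomposition (t₁ + t₂) (λ e → a₁ e + a₂ e)
  decomposition-+ {t₁} {t₂} (β₁ , matchings₁ , multiplicity≡₁) (β₂ , matchings₂ , multiplicity≡₂) =
    β , matchings ,
    λ e → trans (sum-cong-≗ (𝟙-split e)) (trans (sum-++ t₁ _ _) (cong₂ _+_ (multiplicity≡₁ e) (multiplicity≡₂ e)))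
    where
    β : Fin (t₁ + t₂) → Edge → Bool
    β j = [ β₁ , β₂ ]′ (Fin.splitAt t₁ j)
    matchings : ∀ j → IsMatching G (β j)
    matchings j with Fin.splitAt t₁ j
    ... | inj₁ j₁ = matchings₁ j₁
    ... | inj₂ j₂ = matchings₂ j₂
    𝟙-split : ∀ e j → 𝟙 (β j e) ≡ [ (λ j₁ → 𝟙 (β₁ j₁ e)) , (λ j₂ → 𝟙 (β₂ j₂ e)) ]′ (Fin.splitAt t₁ j)
    𝟙-split e j with Fin.splitAt t₁ j
    ... | inj₁ _ = refl
    ... | inj₂ _ = refl

  decomposition-pad : ∀ {t t′ a} → t ≤ t′ → Decomposition t a → Decomposition t′ a
  decomposition-pad {t} {t′} t≤t′ d = subst (λ s → Decomposition s _) (ℕP.m+[n∸m]≡n t≤t′)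
    (decomposition-cong (λ e → ℕP.+-identityʳ _) (decomposition-+ d (empty-decomposition (t′ ∸ t))))

  decomposition-∑ : ∀ {q} (h : Fin q → ℕ) (b : Fin q → Edge → ℕ) → (∀ c → Decomposition (h c) (b c)) →
                    Decomposition (sum h) (λ e → sum (λ c → b c e))
  decomposition-∑ {zero} h b d = empty-decomposition 0
  decomposition-∑ {suc q} h b d =
    decomposition-+ (d Fin.zero) (decomposition-∑ (λ c → h (Fin.suc c)) (λ c → b (Fin.suc c)) (λ c → d (Fin.suc c)))

  stacked-decomposition : ∀ h a → (∀ e e′ → 0 < a e → 0 < a e′ → e ≢ e′ → Disjoint (ends G e) (ends G e′)) →
                          (∀ e → a e ≤ h) → Decomposition h a
  stacked-decomposition h a disjoint a≤h = β , matchings , λ e → count-below h (a e) (a≤h e)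
    where
    β : Fin h → Edge → Bool
    β j e = toℕ j ℕ.<ᵇ a e
    positive : ∀ j e → β j e ≡ true → 0 < a e
    positive j e βe = ℕP.≤-<-trans z≤n (ℕP.<ᵇ⇒< (toℕ j) (a e) (subst T (sym βe) _))
    matchings : ∀ j → IsMatching G (β j)
    matchings j e e′ βe βe′ = disjoint e e′ (positive j e βe) (positive j e′ βe′)

  MatchingBounded : ℕ → (Edge → ℕ) → Set
  MatchingBounded t a = ∀ F b → (∀ M → IsMatching G M → weight F ⟦ M ⟧ ≤ b) → weight F a ≤ t * b

  module _ {t a} (bounded : MatchingBounded t a) where

    clique-bound : ∀ {F} → Clique F → weight F a ≤ t
    clique-bound {F} clique = subst (weight F a ≤_) (ℕP.*-identityʳ t)
      (bounded F 1 (λ M matching → matching-meets-clique≤1 matching clique))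

    degree-bound : ∀ w → degreeOf a w ≤ t
    degree-bound w = clique-bound (incident-Clique w)

  private
    ι : ℕ → ℤ
    ι = ℤ.+_

    indicator≡𝟙 : ∀ (M : Edge → Bool) e → indicator M e ≡ ι (𝟙 (M e))
    indicator≡𝟙 M e with M e
    ... | true = refl
    ... | false = refl

    sumFinℤ-cong : ∀ {k} {f g : Fin k → ℤ} → (∀ i → f i ≡ g i) → sumFinℤ f ≡ sumFinℤ g
    sumFinℤ-cong {zero} f≡g = refl
    sumFinℤ-cong {suc k} f≡g = cong₂ ℤ._+_ (f≡g Fin.zero) (sumFinℤ-cong (λ i → f≡g (Fin.suc i)))

    sumFinℤ-ι : ∀ {k} (f : Fin k → ℕ) → sumFinℤ (λ i → ι (f i)) ≡ ι (sum f)
    sumFinℤ-ι {zero} f = refl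
    sumFinℤ-ι {suc k} f = cong (ℤ._+_ (ι (f Fin.zero))) (sumFinℤ-ι (λ i → f (Fin.suc i)))

    sumFinℤ-single : ∀ {k} (p : Fin k) x → sumFinℤ (λ i → if ⌊ i Fin.≟ p ⌋ then x else ι 0) ≡ x
    sumFinℤ-single {suc k} Fin.zero x = trans (cong (ℤ._+_ x) (zeros k)) (ℤP.+-identityʳ x)
      where
      zeros : ∀ k → sumFinℤ {k} (λ _ → ι 0) ≡ ι 0
      zeros zero = refl
      zeros (suc k) = trans (ℤP.+-identityˡ _) (zeros k)
    sumFinℤ-single {suc k} (Fin.suc p) x = trans (ℤP.+-identityˡ _) (trans (sumFinℤ-cong shift) (sumFinℤ-single p x))
      where
      shift : ∀ i → (if ⌊ Fin.suc i Fin.≟ Fin.suc p ⌋ then x else ι 0) ≡ (if ⌊ i Fin.≟ p ⌋ then x else ι 0)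
      shift i with i Fin.≟ p
      ... | yes refl = refl
      ... | no _ = refl

  module _ (t : ℕ) (α : Edge → ℤ) (α∈tP : InDilate (MatchingVec G) t α) where

    private
      -ε : Edge → Edge → ℤ
      -ε e e′ = if ⌊ e′ Fin.≟ e ⌋ then ℤ.-1ℤ else ι 0

      dot-ε : ∀ e v → dotℤ (-ε e) v ≡ ℤ.- v e
      dot-ε e v = trans (sumFinℤ-cong at-e) (trans (sumFinℤ-single e (ℤ.-1ℤ ℤ.* v e)) (ℤP.-1*i≡-i (v e)))
        where
        at-e : ∀ e′ → -ε e e′ ℤ.* v e′ ≡ (if ⌊ e′ Fin.≟ e ⌋ then ℤ.-1ℤ ℤ.* v e else ι 0)
        at-e e′ with e′ Fin.≟ e
        ... | yes refl = refl
        ... | no _ = refl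

    dilate-nonNegative : ∀ e → ι 0 ℤ.≤ α e
    dilate-nonNegative e = subst (ι 0 ℤ.≤_) (ℤP.neg-involutive (α e))
      (ℤP.neg-mono-≤ (subst₂ ℤ._≤_ (dot-ε e α) (ℤP.*-zeroʳ (ι t)) -αₑ≤0))
      where
      valid : ∀ v → MatchingVec G v → dotℤ (-ε e) v ℤ.≤ ι 0
      valid v (M , _ , v≡) = subst (ℤ._≤ ι 0) (sym (trans (dot-ε e v) (cong ℤ.-_ (trans (v≡ e) (indicator≡𝟙 M e)))))
                               ℤP.neg-≤-pos
      -αₑ≤0 : dotℤ (-ε e) α ℤ.≤ ι t ℤ.* ι 0
      -αₑ≤0 = InDilate⇒dot≤ (MatchingVec G) (-ε e) (ι 0) valid t α α∈tP

    dilate-ℕ : Edge → ℕ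
    dilate-ℕ e = ℤ.∣ α e ∣

    dilate-ℕ-correct : ∀ e → α e ≡ ι (dilate-ℕ e)
    dilate-ℕ-correct e = sym (ℤP.0≤i⇒+∣i∣≡i (dilate-nonNegative e))

    dilate-bounded : MatchingBounded t dilate-ℕ
    dilate-bounded F b bound = ℤ.drop‿+≤+ (subst₂ ℤ._≤_ (dot-F α dilate-ℕ dilate-ℕ-correct) (sym (ℤP.pos-* t b))
                                  (InDilate⇒dot≤ (MatchingVec G) c (ι b) valid t α α∈tP))
      where
      c : Edge → ℤ
      c e = ι (𝟙 (F e))
      c-mask : ∀ x e → c e ℤ.* ι x ≡ ι (mask (F e) x)
      c-mask x e with F e
      ... | true = ℤP.*-identityˡ (ι x)
      ... | false = refl
      dot-F : ∀ v f → (∀ e → v e ≡ ι (f e)) → dotℤ c v ≡ ι (weight F f)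
      dot-F v f v≡ = trans (sumFinℤ-cong (λ e → trans (cong (c e ℤ.*_) (v≡ e)) (c-mask (f e) e)))
                           (sumFinℤ-ι (λ e → mask (F e) (f e)))
      valid : ∀ v → MatchingVec G v → dotℤ c v ℤ.≤ ι b
      valid v (M , matching , v≡) =
        subst (ℤ._≤ ι b) (sym (dot-F v ⟦ M ⟧ (λ e → trans (v≡ e) (indicator≡𝟙 M e)))) (ℤ.+≤+ (bound M matching))

  decomposition⇒sum-of-vertices : ∀ t (α : Edge → ℤ) a → (∀ e → α e ≡ ι (a e)) → Decomposition t a →
    Σ (Fin t → Edge → ℤ) λ γ →
      (∀ j → InConv (MatchingVec G) (λ e → ℤ→ℚ (γ j e))) × (∀ e → α e ≡ sumFinℤ (λ j → γ j e))
  decomposition⇒sum-of-vertices t α a α≡a (β , matchings , multiplicity≡) = (λ j → indicator (β j)) , vertex∈P , α≡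
    where
    vertex∈P : ∀ j → InConv (MatchingVec G) (λ e → ℤ→ℚ (indicator (β j) e))
    vertex∈P j = ((1ℚ , indicator (β j)) ∷ []) ,
                 ((ℤ→ℚ-mono-≤ {ι 0} {ι 1} (ℤ.+≤+ z≤n) , (β j , matchings j , λ e → refl)) ∷ []) ,
                 ℚP.+-identityʳ 1ℚ ,
                 (λ e → sym (trans (ℚP.+-identityʳ _) (ℚP.*-identityˡ _)))
    α≡ : ∀ e → α e ≡ sumFinℤ (λ j → indicator (β j) e)
    α≡ e = trans (α≡a e) (trans (cong ι (sym (multiplicity≡ e)))
             (trans (sym (sumFinℤ-ι (λ j → 𝟙 (β j e)))) (sumFinℤ-cong (λ j → sym (indicator≡𝟙 (β j) e)))))

  IDP-from-decompositions : (∀ t a → MatchingBounded t a → Decomposition t a) → MatchingPolytopeIDP G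
  IDP-from-decompositions decompose t _ α α∈tP =
    decomposition⇒sum-of-vertices t α (dilate-ℕ t α α∈tP) (dilate-ℕ-correct t α α∈tP)
      (decompose t (dilate-ℕ t α α∈tP) (dilate-bounded t α α∈tP))

-- König's edge-colouring theorem

module EdgeColouring (G : Graph) (side : Fin (n G) → Bool) where
  open Incidence G

  Crossing : Edge → Set
  Crossing e = side (end₁ e) ≢ side (end₂ e)

  side-other : ∀ w f → Crossing f → incident w f ≡ true → side (other f w) ≡ not (side w)
  side-other w f crossing inc with incident⇒ w f inc
  ... | inj₁ refl = trans (cong side (other-end₁ f)) (BoolP.¬-not (λ p → crossing (sym p)))
  ... | inj₂ refl = trans (cong side (other-end₂ f)) (BoolP.¬-not crossing)

  Proper : ∀ {t} → (Fin t → Edge → Bool) → Set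
  Proper β = (∀ j → IsMatching G (β j)) × (∀ j f → β j f ≡ true → Crossing f)

  Misses : ∀ {t} → (Fin t → Edge → Bool) → Fin t → Vertex → Set
  Misses β j w = ∀ f → β j f ≡ true → incident w f ≡ false

  module KempeChain {t} (β : Fin t → Edge → Bool) (proper : Proper β) (a b : Fin t)
                    (v : Vertex) (v-misses-b : Misses β b v) where

    colour : Bool → Fin t
    colour true = a
    colour false = b

    even : ℕ → Bool
    even zero = true
    even (suc i) = not (even i)

    Leaves : Bool → Vertex → Edge → Set
    Leaves c w f = β (colour c) f ≡ true × incident w f ≡ true

    leaves? : ∀ c w → Dec (∃ (Leaves c w))
    leaves? c w = FinP.any? (λ f → (β (colour c) f Bool.≟ true) ×-dec (incident w f Bool.≟ true))

    next : Bool → Vertex → Maybe Vertex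
    next c w with leaves? c w
    ... | yes (f , _) = just (other f w)
    ... | no _ = nothing

    next-sound : ∀ c w {w′} → next c w ≡ just w′ → ∃ λ f → Leaves c w f × w′ ≡ other f w
    next-sound c w eq with leaves? c w
    next-sound c w refl | yes (f , leaves) = f , leaves , refl

    next-complete : ∀ c w {f} → Leaves c w f → next c w ≡ just (other f w)
    next-complete c w {f} (βf , inc) with leaves? c w
    ... | yes (f′ , βf′ , inc′) =
      cong (λ g → just (other g w)) (matching-unique-at (proj₁ proper (colour c)) w βf′ βf inc′ inc)
    ... | no none = ⊥-elim (none (f , βf , inc))

    -- The i-th vertex of the walk from v along edges coloured a, b, a, …, unless the walk has stopped.
    chain : ℕ → Maybe Vertex
    chain zero = just v
    chain (suc i) = chain i >>= next (even i)

    Step : ℕ → Vertex → Vertex → Edge → Set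
    Step i w w′ f = chain i ≡ just w × Leaves (even i) w f × w′ ≡ other f w

    chain-step : ∀ i {w′} → chain (suc i) ≡ just w′ → ∃ λ w → ∃ λ f → Step i w w′ f
    chain-step i eq with chain i
    ... | just w with next-sound (even i) w eq
    ... | f , leaves , w′≡ = w , f , refl , leaves , w′≡

    chain-step-back : ∀ i {w′} → chain (suc i) ≡ just w′ →
      ∃ λ w → ∃ λ f → chain i ≡ just w × Leaves (even i) w′ f × w ≡ other f w′
    chain-step-back i eq with chain-step i eq
    ... | w , f , chainᵢ , (βf , inc) , refl =
      w , f , chainᵢ , (βf , incident-other w f inc) , sym (other-involutive w f inc)

    chain-side : ∀ i {w} → chain i ≡ just w → side w ≡ (if even i then side v else not (side v))
    chain-side zero refl = refl
    chain-side (suc i) eq with chain-step i eq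
    ... | w , f , chainᵢ , (βf , inc) , refl with even i | chain-side i chainᵢ
    ... | true | sideᵢ = trans (side-other w f (proj₂ proper a f βf) inc) (cong not sideᵢ)
    ... | false | sideᵢ =
      trans (side-other w f (proj₂ proper b f βf) inc) (trans (cong not sideᵢ) (BoolP.not-involutive (side v)))

    same-vertex⇒same-parity : ∀ i j {w} → chain i ≡ just w → chain j ≡ just w → even i ≡ even j
    same-vertex⇒same-parity i j chainᵢ chainⱼ with even i | even j | chain-side i chainᵢ | chain-side j chainⱼ
    ... | true | true | _ | _ = refl
    ... | false | false | _ | _ = refl
    ... | true | false | p | q = ⊥-elim (BoolP.not-¬ refl (trans (sym p) q))
    ... | false | true | p | q = ⊥-elim (BoolP.not-¬ refl (trans (sym q) p))

    no-return-to-start : ∀ j → chain (suc j) ≡ just v → even (suc j) ≡ true → ⊥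
    no-return-to-start j eq even-suc-j with even j | chain-step-back j eq
    ... | true | _ = true≢false (sym even-suc-j)
    ... | false | _ , f , _ , (βf , inc) , _ = true≢false (trans (sym inc) (v-misses-b f βf))

    chain-injective : ∀ i j {w} → chain i ≡ just w → chain j ≡ just w → i ≡ j
    chain-injective zero zero _ _ = refl
    chain-injective zero (suc j) refl eq =
      ⊥-elim (no-return-to-start j eq (sym (same-vertex⇒same-parity zero (suc j) refl eq)))
    chain-injective (suc i) zero eq refl =
      ⊥-elim (no-return-to-start i eq (same-vertex⇒same-parity (suc i) zero eq refl))
    chain-injective (suc i) (suc j) {w} eqᵢ eqⱼ
      with chain-step-back i eqᵢ | chain-step-back j eqⱼ
    ... | wᵢ , fᵢ , chainᵢ , (βfᵢ , incᵢ) , wᵢ≡ | wⱼ , fⱼ , chainⱼ , (βfⱼ , incⱼ) , wⱼ≡ =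
      cong suc (chain-injective i j chainᵢ (subst (λ x → chain j ≡ just x) (sym wᵢ≡wⱼ) chainⱼ))
      where
      parity : even i ≡ even j
      parity = BoolP.not-injective (same-vertex⇒same-parity (suc i) (suc j) eqᵢ eqⱼ)
      fᵢ≡fⱼ : fᵢ ≡ fⱼ
      fᵢ≡fⱼ = matching-unique-at (proj₁ proper (colour (even j))) w
                (subst (λ c → β (colour c) fᵢ ≡ true) parity βfᵢ) βfⱼ incᵢ incⱼ
      wᵢ≡wⱼ : wᵢ ≡ wⱼ
      wᵢ≡wⱼ = trans wᵢ≡ (trans (cong (λ f → other f w) fᵢ≡fⱼ) (sym wⱼ≡))

    chain-prefix : ∀ i j {w} → i ≤ j → chain j ≡ just w → ∃ λ w′ → chain i ≡ just w′
    chain-prefix i zero {w} z≤n eq = w , eq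
    chain-prefix i (suc j) {w} i≤j eq with ℕP.m≤n⇒m<n∨m≡n i≤j
    ... | inj₂ refl = w , eq
    ... | inj₁ (s≤s i≤j′) with chain-step j eq
    ... | w₀ , _ , chainⱼ , _ = chain-prefix i j i≤j′ chainⱼ

    bound : ℕ
    bound = suc (n G)

    vertexAt : ℕ → Vertex
    vertexAt k = fromMaybe v (chain k)

    chain-ends : chain bound ≡ nothing
    chain-ends with chain bound in eq
    ... | nothing = refl
    ... | just w with FinP.pigeonhole (ℕP.n<1+n (n G)) (λ (i : Fin bound) → vertexAt (toℕ i))
    ... | i , j , i<j , same =
      ⊥-elim (ℕP.<-irrefl (chain-injective _ _ (defined i) (trans (defined j) (cong just (sym same)))) i<j)
      where
      defined : ∀ (k : Fin bound) → chain (toℕ k) ≡ just (vertexAt (toℕ k))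
      defined k with chain-prefix (toℕ k) bound (ℕP.<⇒≤ (FinP.toℕ<n k)) eq
      ... | x , chainₖ rewrite chainₖ = refl

    OnChain : Vertex → Set
    OnChain w = ∃ λ i → i < bound × chain i ≡ just w

    onChain? : ∀ w → Dec (OnChain w)
    onChain? w = ℕP.anyUpTo? (λ i → MaybeP.≡-dec Fin._≟_ (chain i) (just w)) bound

    start-onChain : OnChain v
    start-onChain = 0 , s≤s z≤n , refl

    ab-colour : ∀ f → (β a f ∨ β b f) ≡ true → β (colour (β a f)) f ≡ true
    ab-colour f ab with β a f in βaf
    ... | true = βaf
    ... | false = ab

    private
      forward : ∀ {i w f} → i < bound → chain i ≡ just w → Leaves (even i) w f → OnChain (other f w)
      forward {i} {w} {f} i<bound chainᵢ leaves = suc i , i+1<bound , chainᵢ₊₁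
        where
        chainᵢ₊₁ : chain (suc i) ≡ just (other f w)
        chainᵢ₊₁ = trans (cong (_>>= next (even i)) chainᵢ) (next-complete (even i) w leaves)
        i+1<bound : suc i < bound
        i+1<bound with ℕP.m≤n⇒m<n∨m≡n i<bound
        ... | inj₁ i+1<bound = i+1<bound
        ... | inj₂ refl with trans (sym chainᵢ₊₁) chain-ends
        ... | ()

      backward : ∀ {i w f c} → i < bound → chain i ≡ just w → β (colour c) f ≡ true → c ≢ even i →
                 incident w f ≡ true → OnChain (other f w)
      backward {zero} {w} {f} _ refl βf c≢true inc =
        ⊥-elim (true≢false (trans (sym inc)
          (v-misses-b f (subst (λ x → β (colour x) f ≡ true) (BoolP.¬-not c≢true) βf))))
      backward {suc i} {w} {f} {c} i+1<bound chainᵢ₊₁ βf c≢ inc with chain-step-back i chainᵢ₊₁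
      ... | w₀ , f₀ , chainᵢ , (βf₀ , inc₀) , w₀≡ =
        i , ℕP.<-trans (ℕP.n<1+n i) i+1<bound , subst (λ x → chain i ≡ just x) w₀≡other chainᵢ
        where
        c≡ : c ≡ even i
        c≡ = trans (BoolP.¬-not c≢) (BoolP.not-involutive (even i))
        f≡f₀ : f ≡ f₀
        f≡f₀ = matching-unique-at (proj₁ proper (colour (even i))) w
                 (subst (λ x → β (colour x) f ≡ true) c≡ βf) βf₀ inc inc₀
        w₀≡other : w₀ ≡ other f w
        w₀≡other = trans w₀≡ (cong (λ g → other g w) (sym f≡f₀))

    chain-closed : ∀ {w} f → OnChain w → (β a f ∨ β b f) ≡ true → incident w f ≡ true → OnChain (other f w)
    chain-closed f (i , i<bound , chainᵢ) ab inc with β a f Bool.≟ even i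
    ... | yes same = forward i<bound chainᵢ (subst (λ c → β (colour c) f ≡ true) same (ab-colour f ab) , inc)
    ... | no different = backward i<bound chainᵢ (ab-colour f ab) different inc

  module KempeSwap {t} (β : Fin t → Edge → Bool) (proper : Proper β) (a b : Fin t)
                   (e : Edge) (crossing : Crossing e) (u-misses-a : Misses β a (end₁ e)) (v-misses-b : Misses β b (end₂ e)) where

    open KempeChain β proper a b (end₂ e) v-misses-b

    touched : Edge → Bool
    touched f = ⌊ onChain? (end₁ f) ⌋ ∨ ⌊ onChain? (end₂ f) ⌋

    onChain⇒touched : ∀ {w} f → OnChain w → incident w f ≡ true → touched f ≡ true
    onChain⇒touched {w} f onChain inc with incident⇒ w f inc
    ... | inj₁ refl with onChain? (end₁ f)
    ... | yes _ = refl
    ... | no off = ⊥-elim (off onChain)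
    onChain⇒touched {w} f onChain inc | inj₂ refl with onChain? (end₁ f) | onChain? (end₂ f)
    ... | yes _ | _ = refl
    ... | no _ | yes _ = refl
    ... | no _ | no off = ⊥-elim (off onChain)

    touched⇒onChain : ∀ w f → (β a f ∨ β b f) ≡ true → touched f ≡ true → incident w f ≡ true → OnChain w
    touched⇒onChain w f ab touch inc with onChain? (end₁ f) | onChain? (end₂ f) | incident⇒ w f inc
    ... | yes on₁ | _ | inj₁ refl = on₁
    ... | yes on₁ | _ | inj₂ refl = subst OnChain (other-end₁ f) (chain-closed f on₁ ab (incident-end₁ f))
    ... | no _ | yes on₂ | inj₁ refl = subst OnChain (other-end₂ f) (chain-closed f on₂ ab (incident-end₂ f))
    ... | no _ | yes on₂ | inj₂ refl = on₂

    -- At an even step end₁ e would lie on the side of end₂ e; at an odd step it would be entered along an a-edge.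
    end₁-off-chain : ¬ OnChain (end₁ e)
    end₁-off-chain (i , _ , chainᵢ) with even i in parity
    ... | true =
      crossing (trans (chain-side i chainᵢ) (cong (λ p → if p then side (end₂ e) else not (side (end₂ e))) parity))
    ... | false with i
    ... | suc i′ with chain-step-back i′ chainᵢ
    ... | _ , f , _ , (βf , inc) , _ =
      true≢false (trans (sym inc) (u-misses-a f (subst (λ c → β (colour c) f ≡ true) even-i′ βf)))
      where
      even-i′ : even i′ ≡ true
      even-i′ = trans (sym (BoolP.not-involutive (even i′))) (cong not parity)

    τ : Edge → Fin t → Fin t
    τ f = if touched f then PC.transpose a b else id

    swapped : Fin t → Edge → Bool
    swapped j f = β (τ f j) f

    multiplicity-swapped : ∀ f → multiplicity swapped f ≡ multiplicity β f
    multiplicity-swapped f with touched f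
    ... | true = sym (sum-permute (λ j → 𝟙 (β j f)) (Perm.transpose a b))
    ... | false = refl

    private
      ab-coloured : ∀ {x} f → β x f ≡ true → x ≡ a ⊎ x ≡ b → (β a f ∨ β b f) ≡ true
      ab-coloured f βf (inj₁ refl) = cong (_∨ β b f) βf
      ab-coloured f βf (inj₂ refl) = trans (cong (β a f ∨_) βf) (BoolP.∨-zeroʳ _)

      -- An a/b-edge touching the chain has both ends on it, so every edge at its ends is touched as well.
      touched-untouched : ∀ j f₁ f₂ → touched f₁ ≡ true → touched f₂ ≡ false →
                          β (PC.transpose a b j) f₁ ≡ true → β j f₂ ≡ true → f₁ ≢ f₂ →
                          Disjoint (ends G f₁) (ends G f₂)
      touched-untouched j f₁ f₂ t₁ t₂ βf₁ βf₂ f₁≢f₂ with transpose-cases a b j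
      ... | inj₁ fixed = proj₁ proper j f₁ f₂ (subst (λ x → β x f₁ ≡ true) fixed βf₁) βf₂ f₁≢f₂
      ... | inj₂ moved = ¬common⇒Disjoint f₁ f₂ λ w inc₁ inc₂ →
            let w-onChain = touched⇒onChain w f₁ (ab-coloured f₁ βf₁ moved) t₁ inc₁
            in true≢false (trans (sym (onChain⇒touched f₂ w-onChain inc₂)) t₂)

    swapped-matching : ∀ j → IsMatching G (swapped j)
    swapped-matching j f₁ f₂ βf₁ βf₂ f₁≢f₂ with touched f₁ in t₁ | touched f₂ in t₂
    ... | true | true = proj₁ proper _ f₁ f₂ βf₁ βf₂ f₁≢f₂
    ... | false | false = proj₁ proper j f₁ f₂ βf₁ βf₂ f₁≢f₂
    ... | true | false = touched-untouched j f₁ f₂ t₁ t₂ βf₁ βf₂ f₁≢f₂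
    ... | false | true = Disjoint-sym (touched-untouched j f₂ f₁ t₂ t₁ βf₂ βf₁ (λ p → f₁≢f₂ (sym p)))

    swapped-proper : Proper swapped
    swapped-proper = swapped-matching , λ j f βf → proj₂ proper (τ f j) f βf

    swapped-misses-end₁ : Misses swapped a (end₁ e)
    swapped-misses-end₁ f βf with touched f in touch
    ... | false = u-misses-a f βf
    ... | true with incident (end₁ e) f in inc
    ... | false = refl
    ... | true =
      ⊥-elim (end₁-off-chain (touched⇒onChain (end₁ e) f (ab-coloured f βf (inj₂ (transpose-first a b))) touch inc))

    swapped-misses-end₂ : Misses swapped a (end₂ e)
    swapped-misses-end₂ f βf with touched f in touch
    ... | true = v-misses-b f (subst (λ x → β x f ≡ true) (transpose-first a b) βf)
    ... | false with incident (end₂ e) f in inc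
    ... | false = refl
    ... | true = ⊥-elim (true≢false (trans (sym (onChain⇒touched f start-onChain inc)) touch))

  module _ {t} (β : Fin t → Edge → Bool) (proper : Proper β) (c : Fin t) (e : Edge) (crossing : Crossing e)
           (misses₁ : Misses β c (end₁ e)) (misses₂ : Misses β c (end₂ e)) where

    private
      with-e : Edge → Bool
      with-e f = β c f ∨ ⌊ f Fin.≟ e ⌋

      βce≡false : β c e ≡ false
      βce≡false with β c e in βce
      ... | false = refl
      ... | true = ⊥-elim (true≢false (trans (sym (incident-end₁ e)) (misses₁ e βce)))

      with-e-cases : ∀ f → with-e f ≡ true → f ≡ e ⊎ β c f ≡ true
      with-e-cases f added with f Fin.≟ e
      ... | yes f≡e = inj₁ f≡e
      ... | no _ = inj₂ (trans (sym (BoolP.∨-identityʳ (β c f))) added)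

      e-disjoint : ∀ f → β c f ≡ true → Disjoint (ends G e) (ends G f)
      e-disjoint f βf = ¬common⇒Disjoint e f λ w inc-e inc-f → case incident⇒ w e inc-e of λ
        { (inj₁ refl) → true≢false (trans (sym inc-f) (misses₁ f βf))
        ; (inj₂ refl) → true≢false (trans (sym inc-f) (misses₂ f βf)) }

      with-e-matching : IsMatching G with-e
      with-e-matching f₁ f₂ add₁ add₂ f₁≢f₂ with with-e-cases f₁ add₁ | with-e-cases f₂ add₂
      ... | inj₁ refl | inj₁ refl = ⊥-elim (f₁≢f₂ refl)
      ... | inj₁ refl | inj₂ βf₂ = e-disjoint f₂ βf₂
      ... | inj₂ βf₁ | inj₁ refl = Disjoint-sym (e-disjoint f₁ βf₁)
      ... | inj₂ βf₁ | inj₂ βf₂ = proj₁ proper c f₁ f₂ βf₁ βf₂ f₁≢f₂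

    add-edge : Fin t → Edge → Bool
    add-edge j = if ⌊ j Fin.≟ c ⌋ then with-e else β j

    add-edge-proper : Proper add-edge
    add-edge-proper = matching , crossings
      where
      matching : ∀ j → IsMatching G (add-edge j)
      matching j with j Fin.≟ c
      ... | yes _ = with-e-matching
      ... | no _ = proj₁ proper j
      crossings : ∀ j f → add-edge j f ≡ true → Crossing f
      crossings j f added with j Fin.≟ c
      ... | no _ = proj₂ proper j f added
      ... | yes refl with with-e-cases f added
      ... | inj₁ refl = crossing
      ... | inj₂ βf = proj₂ proper j f βf

    multiplicity-add-edge : ∀ f → multiplicity add-edge f ≡ multiplicity β f + 𝟙 ⌊ f Fin.≟ e ⌋
    multiplicity-add-edge f = begin
      sum (λ j → 𝟙 (add-edge j f))
        ≡⟨ sum-cong-≗ pointwise ⟩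
      sum (λ j → 𝟙 (β j f) + (if ⌊ j Fin.≟ c ⌋ then 𝟙 ⌊ f Fin.≟ e ⌋ else 0))
        ≡⟨ ∑-distrib-+ (λ j → 𝟙 (β j f)) _ ⟩
      multiplicity β f + sum (λ j → if ⌊ j Fin.≟ c ⌋ then 𝟙 ⌊ f Fin.≟ e ⌋ else 0)
        ≡⟨ cong (multiplicity β f +_) (sum-single c (𝟙 ⌊ f Fin.≟ e ⌋)) ⟩
      multiplicity β f + 𝟙 ⌊ f Fin.≟ e ⌋ ∎
      where
      open ≡-Reasoning
      pointwise : ∀ j → 𝟙 (add-edge j f) ≡ 𝟙 (β j f) + (if ⌊ j Fin.≟ c ⌋ then 𝟙 ⌊ f Fin.≟ e ⌋ else 0)
      pointwise j with j Fin.≟ c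
      ... | no _ = sym (ℕP.+-identityʳ _)
      ... | yes refl with f Fin.≟ e
      ... | no _ = trans (cong 𝟙 (BoolP.∨-identityʳ (β j f))) (sym (ℕP.+-identityʳ _))
      ... | yes refl rewrite βce≡false = refl

  missing-colour : ∀ {t} (β : Fin t → Edge → Bool) w → degreeOf (multiplicity β) w < t → ∃ λ j → Misses β j w
  missing-colour {t} β w deg<t with sum<⇒∃< colour-degree 1 (subst₂ _<_ by-colour (sym (ℕP.*-identityʳ t)) deg<t)
    where
    colour-degree : Fin t → ℕ
    colour-degree j = degreeOf (λ f → 𝟙 (β j f)) w
    mask-sum : ∀ x (g : Fin t → ℕ) → mask x (sum g) ≡ sum (λ j → mask x (g j))
    mask-sum true g = refl
    mask-sum false g = sym (sum-replicate-zero t)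
    by-colour : degreeOf (multiplicity β) w ≡ sum colour-degree
    by-colour = trans (sum-cong-≗ (λ f → mask-sum (incident w f) (λ j → 𝟙 (β j f))))
                      (∑-comm (λ f j → mask (incident w f) (𝟙 (β j f))))
  ... | j , zero-degree = j , misses
    where
    misses : Misses β j w
    misses f βf with incident w f in inc
    ... | false = refl
    ... | true with sum≡0⇒≡0 _ (ℕP.n<1⇒n≡0 zero-degree) f
    ... | eq rewrite inc | βf with eq
    ... | ()

  -- Swapping a and b along the Kempe chain from end₂ e frees colour a at both ends of e.
  insert-edge : ∀ {t} (β : Fin t → Edge → Bool) → Proper β → ∀ e → Crossing e →
                degreeOf (multiplicity β) (end₁ e) < t → degreeOf (multiplicity β) (end₂ e) < t →
                Σ (Fin t → Edge → Bool) λ β′ →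
                  Proper β′ × (∀ f → multiplicity β′ f ≡ multiplicity β f + 𝟙 ⌊ f Fin.≟ e ⌋)
  insert-edge β proper e crossing free₁ free₂
    with missing-colour β (end₁ e) free₁ | missing-colour β (end₂ e) free₂
  ... | a , misses₁ | b , misses₂ =
    add-edge swapped swapped-proper a e crossing swapped-misses-end₁ swapped-misses-end₂ ,
    add-edge-proper swapped swapped-proper a e crossing swapped-misses-end₁ swapped-misses-end₂ ,
    λ f → trans (multiplicity-add-edge swapped swapped-proper a e crossing swapped-misses-end₁ swapped-misses-end₂ f)
                (cong (_+ 𝟙 ⌊ f Fin.≟ e ⌋) (multiplicity-swapped f))
    where open KempeSwap β proper a b e crossing misses₁ misses₂

  ProperDecomposition : ℕ → (Edge → ℕ) → Set
  ProperDecomposition t a = Σ (Fin t → Edge → Bool) λ β → Proper β × (∀ f → multiplicity β f ≡ a f)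

  module _ (a : Edge → ℕ) (e : Edge) (aₑ>0 : 0 < a e) where

    private
      δ : Edge → ℕ
      δ f = 𝟙 ⌊ f Fin.≟ e ⌋

    remove : Edge → ℕ
    remove f = a f ∸ δ f

    remove≤ : ∀ f → remove f ≤ a f
    remove≤ f = ℕP.m∸n≤m (a f) (δ f)

    remove+δ : ∀ f → remove f + δ f ≡ a f
    remove+δ f = ℕP.m∸n+n≡m δ≤a
      where
      δ≤a : δ f ≤ a f
      δ≤a with f Fin.≟ e
      ... | yes refl = aₑ>0
      ... | no _ = z≤n

    sum-remove : suc (sum remove) ≡ sum a
    sum-remove = begin
      suc (sum remove)                ≡⟨ ℕP.+-comm 1 (sum remove) ⟩
      sum remove + 1                  ≡⟨ cong (sum remove +_) (sum-single e 1) ⟨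
      sum remove + sum δ              ≡⟨ ∑-distrib-+ remove δ ⟨
      sum (λ f → remove f + δ f)      ≡⟨ sum-cong-≗ remove+δ ⟩
      sum a                           ∎
      where open ≡-Reasoning

    degree-remove : ∀ w → incident w e ≡ true → degreeOf remove w < degreeOf a w
    degree-remove w inc = begin-strict
      degreeOf remove w                       <⟨ ℕP.m<m+n _ (s≤s z≤n) ⟩
      degreeOf remove w + 1                   ≡⟨ cong (degreeOf remove w +_) (trans (weight-single (incident w) e) (cong 𝟙 inc)) ⟨
      degreeOf remove w + degreeOf δ w        ≡⟨ weight-+ (incident w) remove δ ⟨
      degreeOf (λ f → remove f + δ f) w       ≡⟨ weight-cong (incident w) remove+δ ⟩
      degreeOf a w                            ∎
      where open ℕP.≤-Reasoning

    restore : ∀ {t} → Crossing e → (∀ w → degreeOf a w ≤ t) →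
              ProperDecomposition t remove → ProperDecomposition t a
    restore {t} crossing degree≤ (β , proper , multiplicity≡) =
      extend (insert-edge β proper e crossing (free (end₁ e) (incident-end₁ e)) (free (end₂ e) (incident-end₂ e)))
      where
      free : ∀ w → incident w e ≡ true → degreeOf (multiplicity β) w < t
      free w inc = ℕP.<-≤-trans
        (subst (_< degreeOf a w) (weight-cong (incident w) (λ f → sym (multiplicity≡ f))) (degree-remove w inc))
        (degree≤ w)
      extend : Σ (Fin t → Edge → Bool) (λ β′ → Proper β′ × (∀ f → multiplicity β′ f ≡ multiplicity β f + δ f)) →
               ProperDecomposition t a
      extend (β′ , proper′ , multiplicity≡′) =
        β′ , proper′ , λ f → trans (multiplicity≡′ f) (trans (cong (_+ δ f) (multiplicity≡ f)) (remove+δ f))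

  private
    colour-by-size : ∀ t s (a : Edge → ℕ) → sum a ≡ s →
                     (∀ e → 0 < a e → Crossing e) → (∀ w → degreeOf a w ≤ t) → ProperDecomposition t a
    colour-by-size t zero a sum≡0 crossing degree≤ =
      (λ _ _ → false) , ((λ _ _ _ ()) , (λ _ _ ())) , λ f → trans (sum-replicate-zero t) (sym (sum≡0⇒≡0 a sum≡0 f))
    colour-by-size t (suc s) a sum≡ crossing degree≤ with sum>0⇒∃>0 a (subst (0 <_) (sym sum≡) (s≤s z≤n))
    ... | e , aₑ>0 = restore a e aₑ>0 (crossing e aₑ>0) degree≤
      (colour-by-size t s (remove a e aₑ>0) (ℕP.suc-injective (trans (sum-remove a e aₑ>0) sum≡))
        (λ f p → crossing f (ℕP.<-≤-trans p (remove≤ a e aₑ>0 f)))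
        (λ w → ℕP.≤-trans (weight-mono-≤ (incident w) (remove≤ a e aₑ>0)) (degree≤ w)))

  edge-colouring : ∀ t (a : Edge → ℕ) → (∀ e → 0 < a e → Crossing e) → (∀ w → degreeOf a w ≤ t) → Decomposition t a
  edge-colouring t a crossing degree≤ with colour-by-size t (sum a) a refl crossing degree≤
  ... | β , (matchings , _) , multiplicity≡ = β , matchings , multiplicity≡

-- Edge classes and graphs on at most four vertices

module EdgeClasses (G : Graph) {q} (class : Fin (m G) → Fin q)
  (same-class⇒disjoint : ∀ e e′ → class e ≡ class e′ → e ≢ e′ → Disjoint (ends G e) (ends G e′))
  (different-class⇒meet : ∀ e e′ → class e ≢ class e′ → ¬ Disjoint (ends G e) (ends G e′)) where

  open Incidence G

  module _ (t : ℕ) (a : Edge → ℕ) (clique-bound : ∀ {F} → Clique F → weight F a ≤ t) where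

    part : Fin q → Edge → ℕ
    part c e = if ⌊ c Fin.≟ class e ⌋ then a e else 0

    best : ∀ c → (∃ λ e → class e ≡ c × (∀ e′ → class e′ ≡ c → a e′ ≤ a e)) ⊎ (∀ e → class e ≢ c)
    best c = argmax (λ e → class e Fin.≟ c) a

    representative : Fin q → Maybe Edge
    representative c with best c
    ... | inj₁ (e , _) = just e
    ... | inj₂ _ = nothing

    top : Fin q → ℕ
    top c with best c
    ... | inj₁ (e , _) = a e
    ... | inj₂ _ = 0

    part≤top : ∀ c e → part c e ≤ top c
    part≤top c e with c Fin.≟ class e | best c
    ... | no _ | _ = z≤n
    ... | yes refl | inj₁ (_ , _ , max) = max e refl
    ... | yes refl | inj₂ empty = ⊥-elim (empty e refl)

    part-decomposition : ∀ c → Decomposition (top c) (part c)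
    part-decomposition c = stacked-decomposition (top c) (part c) disjoint (part≤top c)
      where
      in-class : ∀ e → 0 < part c e → c ≡ class e
      in-class e pos with c Fin.≟ class e
      ... | yes c≡ = c≡
      disjoint : ∀ e e′ → 0 < part c e → 0 < part c e′ → e ≢ e′ → Disjoint (ends G e) (ends G e′)
      disjoint e e′ pos pos′ = same-class⇒disjoint e e′ (trans (sym (in-class e pos)) (in-class e′ pos′))

    Representative : Edge → Bool
    Representative e = ⌊ MaybeP.≡-dec Fin._≟_ (representative (class e)) (just e) ⌋

    representatives-clique : Clique Representative
    representatives-clique e e′ rep rep′ e≢e′ = different-class⇒meet e e′ λ same →
      e≢e′ (MaybeP.just-injective (trans (sym (is-rep e rep)) (trans (cong representative same) (is-rep e′ rep′))))
      where
      is-rep : ∀ e → Representative e ≡ true → representative (class e) ≡ just e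
      is-rep e rep with MaybeP.≡-dec Fin._≟_ (representative (class e)) (just e)
      ... | yes r = r

    representative-class : ∀ {c e} → representative c ≡ just e → class e ≡ c
    representative-class {c} eq with best c
    representative-class refl | inj₁ (_ , class≡c , _) = class≡c

    sum-top : sum top ≡ weight Representative a
    sum-top = begin
      sum top                                          ≡⟨ sum-cong-≗ top≡ ⟩
      sum (λ c → sum (λ e → mask (chosen c e) (a e)))  ≡⟨ ∑-comm (λ c e → mask (chosen c e) (a e)) ⟩
      sum (λ e → sum (λ c → mask (chosen c e) (a e)))  ≡⟨ sum-cong-≗ (λ e → trans (sum-cong-≗ (only-class e))
                                                                                  (sum-single (class e) _)) ⟩
      weight Representative a                          ∎
      where
      open ≡-Reasoning
      chosen : Fin q → Edge → Bool
      chosen c e = ⌊ MaybeP.≡-dec Fin._≟_ (representative c) (just e) ⌋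
      top≡ : ∀ c → top c ≡ sum (λ e → mask (chosen c e) (a e))
      top≡ c with best c
      ... | inj₂ _ = sym (sum-replicate-zero (m G))
      ... | inj₁ (r , _) = sym (trans (sum-cong-≗ at-r) (sum-single r (a r)))
        where
        at-r : ∀ e → mask ⌊ MaybeP.≡-dec Fin._≟_ (just r) (just e) ⌋ (a e) ≡ (if ⌊ e Fin.≟ r ⌋ then a r else 0)
        at-r e with e Fin.≟ r | r Fin.≟ e
        ... | yes _ | yes refl = refl
        ... | no _ | no _ = refl
        ... | yes e≡r | no r≢e = ⊥-elim (r≢e (sym e≡r))
        ... | no e≢r | yes r≡e = ⊥-elim (e≢r (sym r≡e))
      only-class : ∀ e c → mask (chosen c e) (a e) ≡
                           (if ⌊ c Fin.≟ class e ⌋ then mask (Representative e) (a e) else 0)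
      only-class e c with c Fin.≟ class e
      ... | yes refl = refl
      ... | no c≢ with MaybeP.≡-dec Fin._≟_ (representative c) (just e)
      ... | yes rep = ⊥-elim (c≢ (sym (representative-class rep)))
      ... | no _ = refl

    -- The heaviest edges of the classes form a clique, so the stacked classes need at most t matchings.
    class-decomposition : Decomposition t a
    class-decomposition =
      decomposition-pad (subst (_≤ t) (sym sum-top) (clique-bound representatives-clique))
        (decomposition-cong (λ e → sum-single (class e) (a e)) (decomposition-∑ top part part-decomposition))

-- Reading Fin 4 as (ℤ/2)², the classes of the edges of K₄ under xor are its three perfect matchings.
xor : Fin 4 → Fin 4 → Fin 4
xor 0F y = y
xor x 0F = x
xor 1F 1F = 0F
xor 1F 2F = 3F
xor 1F 3F = 2F
xor 2F 1F = 3F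
xor 2F 2F = 0F
xor 2F 3F = 1F
xor 3F 1F = 2F
xor 3F 2F = 1F
xor 3F 3F = 0F

private
  sameEdge? : ∀ {k} (x y : Fin k × Fin k) → Dec (SameEdge x y)
  sameEdge? (a , b) (c , d) = ((a Fin.≟ c) ×-dec (b Fin.≟ d)) ⊎-dec ((a Fin.≟ d) ×-dec (b Fin.≟ c))

  disjoint? : ∀ {k} (x y : Fin k × Fin k) → Dec (Disjoint x y)
  disjoint? (a , b) (c , d) = ¬? (a Fin.≟ c) ×-dec ¬? (a Fin.≟ d) ×-dec ¬? (b Fin.≟ c) ×-dec ¬? (b Fin.≟ d)

  Pair : Set
  Pair = Fin 4 × Fin 4

  K4-class : Pair → Fin 4
  K4-class (a , b) = xor a b

XorClasses : Pair → Pair → Set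
XorClasses x y = (K4-class x ≡ K4-class y → SameEdge x y ⊎ Disjoint x y) × (K4-class x ≢ K4-class y → ¬ Disjoint x y)

xor-classes : ∀ x y → proj₁ x ≢ proj₂ x → proj₁ y ≢ proj₂ y → XorClasses x y
xor-classes (a , b) (c , d) =
  from-yes (FinP.all? λ a → FinP.all? λ b → FinP.all? λ c → FinP.all? λ d → decide (a , b) (c , d)) a b c d
  where
  decide : ∀ x y → Dec (proj₁ x ≢ proj₂ x → proj₁ y ≢ proj₂ y → XorClasses x y)
  decide x y = ¬? (proj₁ x Fin.≟ proj₂ x) →-dec ¬? (proj₁ y Fin.≟ proj₂ y) →-dec
    (((K4-class x Fin.≟ K4-class y) →-dec (sameEdge? x y ⊎-dec disjoint? x y))
     ×-dec (¬? (K4-class x Fin.≟ K4-class y) →-dec ¬? (disjoint? x y)))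

module _ {k l} (ι : Fin k → Fin l) where

  Disjoint-reflect : ∀ x y → Disjoint (Prod.map ι ι x) (Prod.map ι ι y) → Disjoint x y
  Disjoint-reflect _ _ (d₁₁ , d₁₂ , d₂₁ , d₂₂) =
    (λ p → d₁₁ (cong ι p)) , (λ p → d₁₂ (cong ι p)) , (λ p → d₂₁ (cong ι p)) , (λ p → d₂₂ (cong ι p))

  Disjoint-preserve : (∀ {u v} → ι u ≡ ι v → u ≡ v) → ∀ x y → Disjoint x y → Disjoint (Prod.map ι ι x) (Prod.map ι ι y)
  Disjoint-preserve injective _ _ (d₁₁ , d₁₂ , d₂₁ , d₂₂) =
    (λ p → d₁₁ (injective p)) , (λ p → d₁₂ (injective p)) , (λ p → d₂₁ (injective p)) , (λ p → d₂₂ (injective p))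

module _ (G : Graph) (ι : Fin (n G) → Fin 4) (ι-injective : ∀ {u v} → ι u ≡ ι v → u ≡ v) where

  open Incidence G

  private
    image : Edge → Pair
    image e = Prod.map ι ι (ends G e)

    classes : ∀ e e′ → XorClasses (image e) (image e′)
    classes e e′ = xor-classes (image e) (image e′) (λ eq → noLoop G e (ι-injective eq)) (λ eq → noLoop G e′ (ι-injective eq))

    same-class⇒disjoint : ∀ e e′ → K4-class (image e) ≡ K4-class (image e′) → e ≢ e′ → Disjoint (ends G e) (ends G e′)
    same-class⇒disjoint e e′ same e≢e′ with proj₁ (classes e e′) same
    ... | inj₁ (inj₁ (p , q)) = ⊥-elim (e≢e′ (simple G e e′ (inj₁ (ι-injective p , ι-injective q))))
    ... | inj₁ (inj₂ (p , q)) = ⊥-elim (e≢e′ (simple G e e′ (inj₂ (ι-injective p , ι-injective q))))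
    ... | inj₂ disjoint = Disjoint-reflect ι (ends G e) (ends G e′) disjoint

    different-class⇒meet : ∀ e e′ → K4-class (image e) ≢ K4-class (image e′) → ¬ Disjoint (ends G e) (ends G e′)
    different-class⇒meet e e′ different disjoint =
      proj₂ (classes e e′) different (Disjoint-preserve ι ι-injective (ends G e) (ends G e′) disjoint)

  ≤4-vertices⇒IDP : MatchingPolytopeIDP G
  ≤4-vertices⇒IDP = IDP-from-decompositions λ t a bounded →
    EdgeClasses.class-decomposition G (λ e → K4-class (image e)) same-class⇒disjoint different-class⇒meet
      t a (clique-bound bounded)

-- Paths and cycles

odd : ℕ → Bool
odd zero = false
odd (suc i) = not (odd i)

odd-suc≢ : ∀ i → odd (suc i) ≢ odd i
odd-suc≢ i eq = BoolP.not-¬ refl (sym eq)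

odd-double : ∀ r → odd (r + r) ≡ false
odd-double zero = refl
odd-double (suc r) =
  trans (cong (λ i → not (odd i)) (ℕP.+-suc r r)) (trans (BoolP.not-involutive (odd (r + r))) (odd-double r))

parity-split : ∀ k → (∃ λ r → k ≡ r + r) ⊎ (∃ λ r → k ≡ suc (r + r))
parity-split zero = inj₁ (0 , refl)
parity-split (suc k) with parity-split k
... | inj₁ (r , k≡) = inj₂ (r , cong suc k≡)
... | inj₂ (r , k≡) = inj₁ (suc r , cong suc (trans k≡ (sym (ℕP.+-suc r r))))

CycleRel-sym : ∀ {k} {i j : Fin k} → CycleRel k i j → CycleRel k j i
CycleRel-sym (inj₁ (inj₁ p)) = inj₁ (inj₂ p)
CycleRel-sym (inj₁ (inj₂ p)) = inj₁ (inj₁ p)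
CycleRel-sym (inj₂ (inj₁ p)) = inj₂ (inj₂ p)
CycleRel-sym (inj₂ (inj₂ p)) = inj₂ (inj₁ p)

IsoTo⇒bipartite : ∀ G {k R} → IsoTo G k R → (∀ {i j} → R i j → odd (toℕ i) ≢ odd (toℕ j)) → Bipartite G
IsoTo⇒bipartite G (f , adjacent⇔) parity-changes =
  (λ w → odd (toℕ (Inverse.to f w))) , λ u v adj → parity-changes (Equivalence.to (adjacent⇔ u v) adj)

PathRel-parity : ∀ {k} {i j : Fin k} → PathRel i j → odd (toℕ i) ≢ odd (toℕ j)
PathRel-parity {i = i} (inj₁ p) eq = odd-suc≢ (toℕ i) (trans (cong odd p) (sym eq))
PathRel-parity {j = j} (inj₂ p) eq = odd-suc≢ (toℕ j) (trans (cong odd p) eq)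

even-CycleRel-parity : ∀ {k} → odd k ≡ false → ∀ {i j : Fin k} → CycleRel k i j → odd (toℕ i) ≢ odd (toℕ j)
even-CycleRel-parity even (inj₁ path) = PathRel-parity path
even-CycleRel-parity {k} even {i} {j} (inj₂ (inj₁ (i≡0 , j+1≡k))) eq =
  odd-suc≢ (toℕ j) (trans (cong odd j+1≡k) (trans even (trans (sym (cong odd i≡0)) eq)))
even-CycleRel-parity {k} even {i} {j} (inj₂ (inj₂ (j≡0 , i+1≡k))) eq =
  odd-suc≢ (toℕ i) (trans (cong odd i+1≡k) (trans even (trans (sym (cong odd j≡0)) (sym eq))))

record CycleLabelling (G : Graph) (k : ℕ) : Set where
  field
    label : Fin (n G) → Fin k
    vertex : Fin k → Fin (n G)
    vertex-label : ∀ w → vertex (label w) ≡ w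
    label-vertex : ∀ i → label (vertex i) ≡ i
    edge-related : ∀ e → CycleRel k (label (proj₁ (ends G e))) (label (proj₂ (ends G e)))
    related-adjacent : ∀ i j → CycleRel k i j → Adj G (vertex i) (vertex j)

IsoTo⇒CycleLabelling : ∀ {G k} → IsoTo G k (CycleRel k) → CycleLabelling G k
IsoTo⇒CycleLabelling {G} {k} (f , adjacent⇔) = record
  { label = Inverse.to f
  ; vertex = Inverse.from f
  ; vertex-label = Inverse.strictlyInverseʳ f
  ; label-vertex = Inverse.strictlyInverseˡ f
  ; edge-related = λ e → Equivalence.to (adjacent⇔ _ _) (e , inj₁ (refl , refl))
  ; related-adjacent = λ i j rel → Equivalence.from (adjacent⇔ _ _)
      (subst₂ (CycleRel k) (sym (Inverse.strictlyInverseˡ f i)) (sym (Inverse.strictlyInverseˡ f j)) rel)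
  }

module Rotation (k : ℕ) .{{_ : NonZero k}} where

  Next : Fin k → Fin k → Set
  Next i j = toℕ j ≡ suc (toℕ i) % k

  Next⇒CycleRel : ∀ {i j} → Next i j → CycleRel k i j
  Next⇒CycleRel {i} {j} next with ℕP.m≤n⇒m<n∨m≡n (FinP.toℕ<n i)
  ... | inj₁ i+1<k = inj₁ (inj₁ (sym (trans next (m<n⇒m%n≡m i+1<k))))
  ... | inj₂ i+1≡k = inj₂ (inj₂ (trans next (trans (cong (_% k) i+1≡k) (n%n≡0 k)) , i+1≡k))

  CycleRel⇒Next : ∀ {i j} → CycleRel k i j → Next i j ⊎ Next j i
  CycleRel⇒Next {i} {j} (inj₁ (inj₁ p)) = inj₁ (trans (sym p) (sym (m<n⇒m%n≡m (subst (_< k) (sym p) (FinP.toℕ<n j)))))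
  CycleRel⇒Next {i} {j} (inj₁ (inj₂ p)) = inj₂ (trans (sym p) (sym (m<n⇒m%n≡m (subst (_< k) (sym p) (FinP.toℕ<n i)))))
  CycleRel⇒Next (inj₂ (inj₁ (p , q))) = inj₂ (trans p (sym (trans (cong (_% k) q) (n%n≡0 k))))
  CycleRel⇒Next (inj₂ (inj₂ (p , q))) = inj₁ (trans p (sym (trans (cong (_% k) q) (n%n≡0 k))))

  private
    %-absorbˡ : ∀ a b → (a % k + b) % k ≡ (a + b) % k
    %-absorbˡ a b = begin
      (a % k + b) % k            ≡⟨ %-distribˡ-+ (a % k) b k ⟩
      (a % k % k + b % k) % k    ≡⟨ cong (λ x → (x + b % k) % k) (m%n%n≡m%n a k) ⟩
      (a % k + b % k) % k        ≡⟨ %-distribˡ-+ a b k ⟨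
      (a + b) % k                ∎
      where open ≡-Reasoning

  rotate : ℕ → Fin k → Fin k
  rotate d i = Fin.fromℕ< (m%n<n (toℕ i + d) k)

  toℕ-rotate : ∀ d i → toℕ (rotate d i) ≡ (toℕ i + d) % k
  toℕ-rotate d i = FinP.toℕ-fromℕ< _

  rotate-Next : ∀ d {i j} → Next i j → Next (rotate d i) (rotate d j)
  rotate-Next d {i} {j} next = begin
    toℕ (rotate d j)                 ≡⟨ toℕ-rotate d j ⟩
    (toℕ j + d) % k                  ≡⟨ cong (λ x → (x + d) % k) next ⟩
    (suc (toℕ i) % k + d) % k        ≡⟨ %-absorbˡ (suc (toℕ i)) d ⟩
    (suc (toℕ i) + d) % k            ≡⟨ cong (_% k) (ℕP.+-comm 1 (toℕ i + d)) ⟩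
    (toℕ i + d + 1) % k              ≡⟨ %-absorbˡ (toℕ i + d) 1 ⟨
    ((toℕ i + d) % k + 1) % k        ≡⟨ cong (λ x → (x + 1) % k) (toℕ-rotate d i) ⟨
    (toℕ (rotate d i) + 1) % k       ≡⟨ cong (_% k) (ℕP.+-comm _ 1) ⟩
    suc (toℕ (rotate d i)) % k       ∎
    where open ≡-Reasoning

  rotate-CycleRel : ∀ d {i j} → CycleRel k i j → CycleRel k (rotate d i) (rotate d j)
  rotate-CycleRel d rel with CycleRel⇒Next rel
  ... | inj₁ next = Next⇒CycleRel (rotate-Next d next)
  ... | inj₂ next = CycleRel-sym (Next⇒CycleRel (rotate-Next d next))

  rotate-inverse : ∀ d d′ i → d + d′ ≡ k → rotate d′ (rotate d i) ≡ i
  rotate-inverse d d′ i d+d′≡k = FinP.toℕ-injective (begin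
    toℕ (rotate d′ (rotate d i))     ≡⟨ toℕ-rotate d′ (rotate d i) ⟩
    (toℕ (rotate d i) + d′) % k      ≡⟨ cong (λ x → (x + d′) % k) (toℕ-rotate d i) ⟩
    ((toℕ i + d) % k + d′) % k       ≡⟨ %-absorbˡ (toℕ i + d) d′ ⟩
    (toℕ i + d + d′) % k             ≡⟨ cong (_% k) (trans (ℕP.+-assoc (toℕ i) d d′) (cong (toℕ i +_) d+d′≡k)) ⟩
    (toℕ i + k) % k                  ≡⟨ [m+n]%n≡m%n (toℕ i) k ⟩
    toℕ i % k                        ≡⟨ m<n⇒m%n≡m (FinP.toℕ<n i) ⟩
    toℕ i                            ∎)
    where open ≡-Reasoning

  rotated : ∀ {G} → CycleLabelling G k → (d : ℕ) → d ≤ k → CycleLabelling G k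
  rotated L d d≤k = record
    { label = λ w → rotate d (label w)
    ; vertex = λ i → vertex (rotate (k ∸ d) i)
    ; vertex-label = λ w →
        trans (cong vertex (rotate-inverse d (k ∸ d) (label w) (ℕP.m+[n∸m]≡n d≤k))) (vertex-label w)
    ; label-vertex = λ i →
        trans (cong (rotate d) (label-vertex (rotate (k ∸ d) i))) (rotate-inverse (k ∸ d) d i (ℕP.m∸n+n≡m d≤k))
    ; edge-related = λ e → rotate-CycleRel d (edge-related e)
    ; related-adjacent = λ i j rel → related-adjacent _ _ (rotate-CycleRel (k ∸ d) rel)
    }
    where open CycleLabelling L

  recentred : ∀ {G} → CycleLabelling G k → Fin k → CycleLabelling G k
  recentred L i = rotated L (k ∸ toℕ i) (ℕP.m∸n≤m k (toℕ i))

  Next-to-zero : ∀ {i j} → Next i j → toℕ j ≡ 0 → suc (toℕ i) ≡ k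
  Next-to-zero {i} next j≡0 with ℕP.m≤n⇒m<n∨m≡n (FinP.toℕ<n i)
  ... | inj₂ i+1≡k = i+1≡k
  ... | inj₁ i+1<k with trans (sym j≡0) (trans next (m<n⇒m%n≡m i+1<k))
  ... | ()

  rotate-to-zero : ∀ i → toℕ (rotate (k ∸ toℕ i) i) ≡ 0
  rotate-to-zero i = begin
    toℕ (rotate (k ∸ toℕ i) i)   ≡⟨ toℕ-rotate (k ∸ toℕ i) i ⟩
    (toℕ i + (k ∸ toℕ i)) % k    ≡⟨ cong (_% k) (ℕP.m+[n∸m]≡n (ℕP.<⇒≤ (FinP.toℕ<n i))) ⟩
    k % k                        ≡⟨ n%n≡0 k ⟩
    0                            ∎
    where open ≡-Reasoning

module OddCycle (G : Graph) (r : ℕ) (n≡k : n G ≡ suc (r + r)) where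

  open Incidence G
  open EdgeColouring G using (Crossing; edge-colouring)

  k : ℕ
  k = suc (r + r)

  open Rotation k

  module Positions (L : CycleLabelling G k) where

    open CycleLabelling L

    pos : Vertex → ℕ
    pos w = toℕ (label w)

    pos-injective : ∀ {u v} → pos u ≡ pos v → u ≡ v
    pos-injective {u} {v} eq = trans (sym (vertex-label u)) (trans (cong vertex (FinP.toℕ-injective eq)) (vertex-label v))

    Spans : Edge → ℕ → ℕ → Set
    Spans e i j = (pos (end₁ e) ≡ i × pos (end₂ e) ≡ j) ⊎ (pos (end₁ e) ≡ j × pos (end₂ e) ≡ i)

    spans-unique : ∀ {e f i j} → Spans e i j → Spans f i j → e ≡ f
    spans-unique {e} {f} spans-e spans-f = simple G e f (same-ends spans-e spans-f)
      where
      same : ∀ {u v x} → pos u ≡ x → pos v ≡ x → u ≡ v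
      same p q = pos-injective (trans p (sym q))
      same-ends : ∀ {i j} → Spans e i j → Spans f i j → SameEdge (ends G e) (ends G f)
      same-ends (inj₁ (p₁ , p₂)) (inj₁ (q₁ , q₂)) = inj₁ (same p₁ q₁ , same p₂ q₂)
      same-ends (inj₁ (p₁ , p₂)) (inj₂ (q₁ , q₂)) = inj₂ (same p₁ q₂ , same p₂ q₁)
      same-ends (inj₂ (p₁ , p₂)) (inj₁ (q₁ , q₂)) = inj₂ (same p₁ q₂ , same p₂ q₁)
      same-ends (inj₂ (p₁ , p₂)) (inj₂ (q₁ , q₂)) = inj₁ (same p₁ q₁ , same p₂ q₂)

    spans-incident : ∀ {e i j} w → Spans e i j → incident w e ≡ true → pos w ≡ i ⊎ pos w ≡ j
    spans-incident {e} w spans inc with incident⇒ w e inc | spans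
    ... | inj₁ refl | inj₁ (p , _) = inj₁ p
    ... | inj₁ refl | inj₂ (p , _) = inj₂ p
    ... | inj₂ refl | inj₁ (_ , q) = inj₂ q
    ... | inj₂ refl | inj₂ (_ , q) = inj₁ q

    spans-endpoint : ∀ {e i j} w → Spans e i j → pos w ≡ i ⊎ pos w ≡ j → incident w e ≡ true
    spans-endpoint w (inj₁ (p , _)) (inj₁ q) = ⇒incident (inj₁ (pos-injective (trans q (sym p))))
    spans-endpoint w (inj₁ (_ , p)) (inj₂ q) = ⇒incident (inj₂ (pos-injective (trans q (sym p))))
    spans-endpoint w (inj₂ (_ , p)) (inj₁ q) = ⇒incident (inj₂ (pos-injective (trans q (sym p))))
    spans-endpoint w (inj₂ (p , _)) (inj₂ q) = ⇒incident (inj₁ (pos-injective (trans q (sym p))))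

    pos-vertex : ∀ {w} i → w ≡ vertex i → pos w ≡ toℕ i
    pos-vertex i refl = cong toℕ (label-vertex i)

    related⇒edge : ∀ i j → CycleRel k i j → ∃ λ f → Spans f (toℕ i) (toℕ j)
    related⇒edge i j rel with related-adjacent i j rel
    ... | f , inj₁ (p , q) = f , inj₁ (pos-vertex i p , pos-vertex j q)
    ... | f , inj₂ (p , q) = f , inj₂ (pos-vertex j p , pos-vertex i q)

    consecutive-edge : ∀ i → suc i < k → ∃ λ f → Spans f i (suc i)
    consecutive-edge i i+1<k with related⇒edge (Fin.fromℕ< i<k) (Fin.fromℕ< i+1<k) (inj₁ (inj₁ next))
      where
      i<k = ℕP.<-trans (ℕP.n<1+n i) i+1<k
      next : suc (toℕ (Fin.fromℕ< i<k)) ≡ toℕ (Fin.fromℕ< i+1<k)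
      next = trans (cong suc (FinP.toℕ-fromℕ< i<k)) (sym (FinP.toℕ-fromℕ< i+1<k))
    ... | f , spans = f , subst₂ (Spans f) (FinP.toℕ-fromℕ< _) (FinP.toℕ-fromℕ< i+1<k) spans

    edge-shape : ∀ e → (∃ λ i → Spans e i (suc i)) ⊎ Spans e 0 (r + r)
    edge-shape e with edge-related e
    ... | inj₁ (inj₁ p) = inj₁ (_ , inj₁ (refl , sym p))
    ... | inj₁ (inj₂ p) = inj₁ (_ , inj₂ (sym p , refl))
    ... | inj₂ (inj₁ (p , q)) = inj₂ (inj₁ (p , ℕP.suc-injective q))
    ... | inj₂ (inj₂ (p , q)) = inj₂ (inj₂ (ℕP.suc-injective q , p))

    module NearPerfectMatching (x : Vertex) (x-at-0 : pos x ≡ 0) where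

      -- The edges {1,2}, {3,4}, …, {2r−1,2r}; the wrap-around edge {2r,0} has even smaller end.
      M : Edge → Bool
      M e = odd (pos (end₁ e) ℕ.⊓ pos (end₂ e))

      private
        lower-spans : ∀ {e i} → Spans e i (suc i) → pos (end₁ e) ℕ.⊓ pos (end₂ e) ≡ i
        lower-spans {i = i} (inj₁ (p , q)) rewrite p | q = ℕP.m≤n⇒m⊓n≡m (ℕP.n≤1+n i)
        lower-spans {i = i} (inj₂ (p , q)) rewrite p | q = ℕP.m≥n⇒m⊓n≡n (ℕP.n≤1+n i)

        lower-wrap : ∀ {e} → Spans e 0 (r + r) → pos (end₁ e) ℕ.⊓ pos (end₂ e) ≡ 0
        lower-wrap (inj₁ (p , _)) rewrite p = refl
        lower-wrap (inj₂ (_ , q)) rewrite q = ℕP.⊓-zeroʳ _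

      M⇒odd-pair : ∀ e → M e ≡ true → ∃ λ o → odd o ≡ true × Spans e o (suc o)
      M⇒odd-pair e Me with edge-shape e
      ... | inj₁ (i , spans) = i , trans (cong odd (sym (lower-spans spans))) Me , spans
      ... | inj₂ wrap with trans (sym (cong odd (lower-wrap wrap))) Me
      ... | ()

      odd-pair⇒M : ∀ {e o} → odd o ≡ true → Spans e o (suc o) → M e ≡ true
      odd-pair⇒M odd-o spans = trans (cong odd (lower-spans spans)) odd-o

      M-matching : IsMatching G M
      M-matching e e′ Me Me′ e≢e′ with M⇒odd-pair e Me | M⇒odd-pair e′ Me′
      ... | o , odd-o , spans | o′ , odd-o′ , spans′ = ¬common⇒Disjoint e e′ λ w inc inc′ →
        e≢e′ (spans-unique spans (subst (λ p → Spans e′ p (suc p)) (sym (o≡o′ w inc inc′)) spans′))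
        where
        same-pair : ∀ {i} → i ≡ o ⊎ i ≡ suc o → i ≡ o′ ⊎ i ≡ suc o′ → o ≡ o′
        same-pair (inj₁ p) (inj₁ q) = trans (sym p) q
        same-pair (inj₂ p) (inj₂ q) = ℕP.suc-injective (trans (sym p) q)
        same-pair (inj₁ p) (inj₂ q) =
          ⊥-elim (odd-suc≢ o′ (trans (cong odd (trans (sym q) p)) (trans odd-o (sym odd-o′))))
        same-pair (inj₂ p) (inj₁ q) =
          ⊥-elim (odd-suc≢ o (trans (cong odd (trans (sym p) q)) (trans odd-o′ (sym odd-o))))
        o≡o′ : ∀ w → incident w e ≡ true → incident w e′ ≡ true → o ≡ o′
        o≡o′ w inc inc′ = same-pair (spans-incident w spans inc) (spans-incident w spans′ inc′)

      M-avoids : ∀ f → M f ≡ true → incident x f ≡ false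
      M-avoids f Mf with incident x f in inc
      ... | false = refl
      ... | true with M⇒odd-pair f Mf
      ... | o , odd-o , spans with spans-incident x spans inc
      ... | inj₁ x-at-o = ⊥-elim (BoolP.not-¬ refl (trans (sym odd-o) (cong odd (trans (sym x-at-o) x-at-0))))
      ... | inj₂ x-at-o+1 with trans (sym x-at-o+1) x-at-0
      ... | ()

      M-covers : ∀ w → w ≢ x → ∃ λ f → M f ≡ true × incident w f ≡ true
      M-covers w w≢x with pos w in pos-w | odd (pos w) in parity
      ... | zero | _ = ⊥-elim (w≢x (pos-injective (trans pos-w (sym x-at-0))))
      ... | suc i | true with consecutive-edge (suc i) i+2<k
        where
        i+2<k : suc (suc i) < k
        i+2<k with ℕP.m≤n⇒m<n∨m≡n (subst (_< k) pos-w (FinP.toℕ<n (label w)))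
        ... | inj₁ lt = lt
        ... | inj₂ i+2≡k =
          ⊥-elim (true≢false (trans (sym parity) (trans (cong odd (ℕP.suc-injective i+2≡k)) (odd-double r))))
      ... | f , spans = f , odd-pair⇒M parity spans , spans-endpoint w spans (inj₁ pos-w)
      M-covers w w≢x | suc i | false with consecutive-edge i (subst (_< k) pos-w (FinP.toℕ<n (label w)))
      ... | f , spans = f , odd-pair⇒M odd-i spans , spans-endpoint w spans (inj₂ pos-w)
        where
        odd-i : odd i ≡ true
        odd-i = trans (sym (BoolP.not-involutive (odd i))) (cong not parity)

      M-degree : ∀ w → degreeOf ⟦ M ⟧ w + 𝟙 ⌊ w Fin.≟ x ⌋ ≡ 1
      M-degree w with w Fin.≟ x
      ... | yes refl = cong (_+ 1) (trans (sum-cong-≗ uncovered) (sum-replicate-zero (m G)))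
        where
        uncovered : ∀ f → mask (incident w f) (𝟙 (M f)) ≡ 0
        uncovered f with M f in Mf
        ... | true rewrite M-avoids f Mf = refl
        ... | false with incident w f
        ... | true = refl
        ... | false = refl
      ... | no w≢x = trans (ℕP.+-identityʳ _) (ℕP.≤-antisym (matching-meets-clique≤1 M-matching (incident-Clique w)) covered)
        where
        covered : 1 ≤ degreeOf ⟦ M ⟧ w
        covered with M-covers w w≢x
        ... | f , Mf , inc = subst (_≤ degreeOf ⟦ M ⟧ w) (cong₂ (λ b c → mask b (𝟙 c)) inc Mf)
                               (≤-sum (λ f → mask (incident w f) (𝟙 (M f))) f)

      M-size : size M ≡ r
      M-size = ℕP.*-cancelˡ-≡ (size M) r 2 (ℕP.suc-injective (begin
        suc (2 * size M)                                                   ≡⟨ ℕP.+-comm 1 _ ⟩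
        2 * size M + 1                                                     ≡⟨ cong₂ _+_ (handshake ⟦ M ⟧) (sum-single x 1) ⟨
        sum (degreeOf ⟦ M ⟧) + sum (λ w → 𝟙 ⌊ w Fin.≟ x ⌋)      ≡⟨ ∑-distrib-+ (degreeOf ⟦ M ⟧) _ ⟨
        sum (λ w → degreeOf ⟦ M ⟧ w + 𝟙 ⌊ w Fin.≟ x ⌋)          ≡⟨ sum-cong-≗ M-degree ⟩
        sum {n G} (λ _ → 1)                                                ≡⟨ trans (sum-ones (n G)) n≡k ⟩
        suc (r + r)                                                        ≡⟨ cong (λ s → suc (r + s)) (ℕP.+-identityʳ r) ⟨
        suc (2 * r)                                                        ∎))
        where open ≡-Reasoning

  module _ (L₀ : CycleLabelling G k) where

    open CycleLabelling L₀ using () renaming (label to label₀; edge-related to edge-related₀)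
    open Positions

    centred : ∀ x → Σ (CycleLabelling G k) λ L → pos L x ≡ 0
    centred x = recentred L₀ (label₀ x) , rotate-to-zero (label₀ x)

    wrapping : ∀ e₀ → Σ (CycleLabelling G k) λ L → Spans L e₀ 0 (r + r)
    wrapping e₀ with CycleRel⇒Next (edge-related₀ e₀)
    ... | inj₁ next = L , inj₂ (ℕP.suc-injective (Next-to-zero (rotate-Next d next) end₂-at-0) , end₂-at-0)
      where
      d = k ∸ toℕ (label₀ (end₂ e₀))
      L = recentred L₀ (label₀ (end₂ e₀))
      end₂-at-0 : pos L (end₂ e₀) ≡ 0
      end₂-at-0 = rotate-to-zero (label₀ (end₂ e₀))
    ... | inj₂ next = L , inj₁ (end₁-at-0 , ℕP.suc-injective (Next-to-zero (rotate-Next d next) end₁-at-0))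
      where
      d = k ∸ toℕ (label₀ (end₁ e₀))
      L = recentred L₀ (label₀ (end₁ e₀))
      end₁-at-0 : pos L (end₁ e₀) ≡ 0
      end₁-at-0 = rotate-to-zero (label₀ (end₁ e₀))

    -- With e₀ rotated to {2r,0}, every other edge joins positions of opposite parity.
    zero-edge-decomposition : ∀ t a e₀ → a e₀ ≡ 0 → (∀ w → degreeOf a w ≤ t) → Decomposition t a
    zero-edge-decomposition t a e₀ aₑ₀≡0 degree≤ with wrapping e₀
    ... | L , e₀-wraps = edge-colouring side t a crossing degree≤
      where
      side : Vertex → Bool
      side w = odd (pos L w)
      crossing : ∀ f → 0 < a f → Crossing side f
      crossing f aₓ>0 with edge-shape L f
      ... | inj₁ (i , inj₁ (p , q)) = λ same → odd-suc≢ i (trans (cong odd (sym q)) (trans (sym same) (cong odd p)))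
      ... | inj₁ (i , inj₂ (p , q)) = λ same → odd-suc≢ i (trans (cong odd (sym p)) (trans same (cong odd q)))
      ... | inj₂ f-wraps with spans-unique L f-wraps e₀-wraps
      ... | refl = ⊥-elim (ℕP.<⇒≢ aₓ>0 (sym aₑ₀≡0))

    module Peel (t : ℕ) (a : Edge → ℕ) (positive : ∀ e → 1 ≤ a e)
                (degree≤ : ∀ w → degreeOf a w ≤ suc t) (sum≤ : sum a ≤ suc t * r) where

      private
        double : ∀ s → 2 * (s * r) ≡ (r + r) * s
        double s = trans (cong (s * r +_) (ℕP.+-identityʳ (s * r)))
                     (trans (cong₂ _+_ (ℕP.*-comm s r) (ℕP.*-comm s r)) (sym (ℕP.*-distribʳ-+ s r r)))

      deficient : ∃ λ x → degreeOf a x < suc t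
      deficient = sum<⇒∃< (degreeOf a) (suc t) (begin-strict
        sum (degreeOf a)            ≡⟨ handshake a ⟩
        2 * sum a                   ≤⟨ ℕP.*-monoʳ-≤ 2 sum≤ ⟩
        2 * (suc t * r)             ≡⟨ double (suc t) ⟩
        (r + r) * suc t             <⟨ ℕP.m<n+m _ (s≤s z≤n) ⟩
        suc t + (r + r) * suc t     ≡⟨ cong (_* suc t) n≡k ⟨
        n G * suc t                 ∎)
        where open ℕP.≤-Reasoning

      x : Vertex
      x = proj₁ deficient

      open NearPerfectMatching (proj₁ (centred x)) x (proj₂ (centred x))

      rest : Edge → ℕ
      rest e = a e ∸ 𝟙 (M e)

      a≡M+rest : ∀ e → a e ≡ 𝟙 (M e) + rest e
      a≡M+rest e = sym (ℕP.m+[n∸m]≡n (ℕP.≤-trans (𝟙≤1 (M e)) (positive e)))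
        where
        𝟙≤1 : ∀ b → 𝟙 b ≤ 1
        𝟙≤1 true = ℕP.≤-refl
        𝟙≤1 false = z≤n

      rest-degree≤ : ∀ w → degreeOf rest w ≤ t
      rest-degree≤ w = ℕP.≤-pred (subst (_≤ suc t) shifted loaded)
        where
        open ≡-Reasoning
        loaded : degreeOf a w + 𝟙 ⌊ w Fin.≟ x ⌋ ≤ suc t
        loaded with w Fin.≟ x
        ... | yes refl = subst (_≤ suc t) (ℕP.+-comm 1 _) (proj₂ deficient)
        ... | no _ = subst (_≤ suc t) (sym (ℕP.+-identityʳ _)) (degree≤ w)
        shifted : degreeOf a w + 𝟙 ⌊ w Fin.≟ x ⌋ ≡ suc (degreeOf rest w)
        shifted = begin
          degreeOf a w + 𝟙 ⌊ w Fin.≟ x ⌋                      ≡⟨ cong (_+ 𝟙 ⌊ w Fin.≟ x ⌋) split ⟩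
          degreeOf ⟦ M ⟧ w + degreeOf rest w + 𝟙 ⌊ w Fin.≟ x ⌋  ≡⟨ xy∙z≈y∙xz (degreeOf ⟦ M ⟧ w) _ _ ⟩
          degreeOf rest w + (degreeOf ⟦ M ⟧ w + 𝟙 ⌊ w Fin.≟ x ⌋) ≡⟨ cong (degreeOf rest w +_) (M-degree w) ⟩
          degreeOf rest w + 1                                   ≡⟨ ℕP.+-comm _ 1 ⟩
          suc (degreeOf rest w)                                 ∎
          where
          split : degreeOf a w ≡ degreeOf ⟦ M ⟧ w + degreeOf rest w
          split = trans (weight-cong (incident w) a≡M+rest) (weight-+ (incident w) ⟦ M ⟧ rest)

      rest-sum≤ : sum rest ≤ t * r
      rest-sum≤ = ℕP.+-cancelˡ-≤ r _ _ (begin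
        r + sum rest                       ≡⟨ cong (_+ sum rest) M-size ⟨
        size M + sum rest                  ≡⟨ ∑-distrib-+ ⟦ M ⟧ rest ⟨
        sum (λ e → 𝟙 (M e) + rest e)       ≡⟨ sum-cong-≗ a≡M+rest ⟨
        sum a                              ≤⟨ sum≤ ⟩
        r + t * r                          ∎)
        where open ℕP.≤-Reasoning

      add-M : Decomposition t rest → Decomposition (suc t) a
      add-M d = decomposition-cong (λ e → sym (a≡M+rest e)) (decomposition-+ (matching-decomposition M-matching) d)

    odd-cycle-decomposition : ∀ t a → (∀ w → degreeOf a w ≤ t) → sum a ≤ t * r → Decomposition t a
    odd-cycle-decomposition zero a degree≤ _ =
      decomposition-cong (λ e → sym (ℕP.n≤0⇒n≡0 (ℕP.≤-trans (≤-degreeOf a e) (degree≤ (end₁ e))))) (empty-decomposition 0)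
    odd-cycle-decomposition (suc t) a degree≤ sum≤ with FinP.any? (λ e → a e ℕ.≟ 0)
    ... | yes (e₀ , aₑ₀≡0) = zero-edge-decomposition (suc t) a e₀ aₑ₀≡0 degree≤
    ... | no no-zero = add-M (odd-cycle-decomposition t rest rest-degree≤ rest-sum≤)
      where
      positive : ∀ e → 1 ≤ a e
      positive e = ℕP.n≢0⇒n>0 (λ aₑ≡0 → no-zero (e , aₑ≡0))
      open Peel t a positive degree≤ sum≤

bipartite⇒IDP : ∀ G → Bipartite G → MatchingPolytopeIDP G
bipartite⇒IDP G (side , proper) = IDP-from-decompositions λ t a bounded →
  edge-colouring side t a (λ e _ → proper (end₁ e) (end₂ e) (e , inj₁ (refl , refl))) (degree-bound bounded)
  where
  open Incidence G
  open EdgeColouring G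

↔-≤4⇒IDP : ∀ G {k} → k ≤ 4 → Fin (n G) ↔ Fin k → MatchingPolytopeIDP G
↔-≤4⇒IDP G k≤4 f = ≤4-vertices⇒IDP G (λ w → Fin.inject≤ (Inverse.to f w) k≤4)
  (λ eq → Injection.injective (↔⇒↣ f) (FinP.inject≤-injective k≤4 k≤4 _ _ eq))

path⇒IDP : ∀ G → IsPath G → MatchingPolytopeIDP G
path⇒IDP G (k , _ , iso) = bipartite⇒IDP G (IsoTo⇒bipartite G {R = PathRel} iso PathRel-parity)

odd-cycle⇒IDP : ∀ G r → IsoTo G (suc (r + r)) (CycleRel (suc (r + r))) → MatchingPolytopeIDP G
odd-cycle⇒IDP G r iso = IDP-from-decompositions λ t a bounded →
  odd-cycle-decomposition (IsoTo⇒CycleLabelling iso) t a (degree-bound bounded)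
    (bounded _ r λ M matching → half (ℕP.≤-trans (matching-size matching) (ℕP.≤-reflexive n≡k)))
  where
  open Incidence G
  n≡k = Perm.↔⇒≡ (proj₁ iso)
  open OddCycle G r n≡k
  half : ∀ {s} → 2 * s ≤ suc (r + r) → s ≤ r
  half {s} 2s≤ = ℕP.≤-pred (ℕP.*-cancelˡ-< 2 s (suc r) (ℕP.≤-<-trans 2s≤ (ℕP.≤-reflexive (cong suc
    (trans (sym (ℕP.+-suc r r)) (cong (λ z → r + suc z) (sym (ℕP.+-identityʳ r))))))))

cycle⇒IDP : ∀ G → IsCycle G → MatchingPolytopeIDP G
cycle⇒IDP G (k , _ , iso) with parity-split k
... | inj₁ (r , k≡r+r) = bipartite⇒IDP G (IsoTo⇒bipartite G {R = CycleRel k} iso (even-CycleRel-parity even))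
  where
  even : odd k ≡ false
  even = trans (cong odd k≡r+r) (odd-double r)
... | inj₂ (r , refl) = odd-cycle⇒IDP G r iso

proposition3p5 : (∀ (G : Graph) →
    (Bipartite G ⊎ IsK3 G ⊎ IsK4 G ⊎ IsK112 G ⊎ IsPath G ⊎ IsCycle G) →
    MatchingPolytopeIDP G)
    × (∀ (G : Graph) →
    ((Connected G × Bipartite G × SameEssentialDegree G) ⊎ IsoTo G 5 (CycleRel 5)) →
    MatchingPolytopeIDP G)
proposition3p5 = listed-classes , special-cases
  where
  listed-classes : ∀ G → Bipartite G ⊎ IsK3 G ⊎ IsK4 G ⊎ IsK112 G ⊎ IsPath G ⊎ IsCycle G → MatchingPolytopeIDP G
  listed-classes G (inj₁ bipartite) = bipartite⇒IDP G bipartite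
  listed-classes G (inj₂ (inj₁ K₃)) = ↔-≤4⇒IDP G (ℕP.n≤1+n 3) (proj₁ K₃)
  listed-classes G (inj₂ (inj₂ (inj₁ K₄))) = ↔-≤4⇒IDP G ℕP.≤-refl (proj₁ K₄)
  listed-classes G (inj₂ (inj₂ (inj₂ (inj₁ K₁₁₂)))) = ↔-≤4⇒IDP G ℕP.≤-refl (proj₁ K₁₁₂)
  listed-classes G (inj₂ (inj₂ (inj₂ (inj₂ (inj₁ path))))) = path⇒IDP G path
  listed-classes G (inj₂ (inj₂ (inj₂ (inj₂ (inj₂ cycle))))) = cycle⇒IDP G cycle
  special-cases : ∀ G → (Connected G × Bipartite G × SameEssentialDegree G) ⊎ IsoTo G 5 (CycleRel 5) →
                  MatchingPolytopeIDP G
  special-cases G (inj₁ (_ , bipartite , _)) = bipartite⇒IDP G bipartite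
  special-cases G (inj₂ C₅) = odd-cycle⇒IDP G 2 C₅
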